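{- Let $n$ be a positive integer and let $A$ and $B$ be two different subsets of $\{1,2,\ldots,n\}$ with $n\in A\cap B$ and $H(\lambda_A)=H(\lambda_B)$. Then the partitions $\lambda_A$ and $\lambda_B$ are conjugate to each other if and only if $A\setminus B$ and $B\setminus A$ are both $n$-symmetric sets, where a set $S$ is called $n$-symmetric if $S=\{n-x : x\in S\}$.
   Context: A partition is a finite weakly decreasing sequence of positive integers $\lambda=(\lambda_1,\ldots,\lambda_m)$, visualized by its Young diagram (left-justified rows, $\lambda_i$ boxes in row $i$). The hook length of a box is the number of boxes in the same row to its right, plus the number of boxes in the same column below it, plus one. The hook multiset $H(\lambda)$ is the multiset of hook lengths of all boxes of $\lambda$. The $\beta$-set of $\lambda=(\lambda_1,\ldots,\lambda_m)$ is $\beta(\lambda)=\{\lambda_i+m-i: 1\le i\le m\}$; a partition is uniquely determined by its $\beta$-set, and for a finite set $A$ of positive integers, $\lambda_A$ denotes the partition whose $\beta$-set is $A$. The conjugate of $\lambda$ is $\lambda'=(\lambda'_1,\ldots,\lambda'_{\lambda_1})$ with $\lambda'_i=\#\{j:\lambda_j\ge i\}$. -}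

module Defs where

open import Data.Nat using (ℕ; zero; suc; _+_; _∸_; _≤?_)
open import Data.Fin using (Fin; toℕ)
open import Data.Fin.Subset using (Subset; _∈_; _─_)
open import Data.Fin.Subset.Properties using (_∈?_)
open import Data.List using (List; []; _∷_; length; filter; map; concat; zipWith; applyUpTo; reverse; allFin)
open import Data.Product using (Σ; _×_)
open import Function.Bundles using (_⇔_)
open import Relation.Binary.PropositionalEquality using (_≡_)

-- A partition is a weakly decreasing list of positive naturals (λ₁,…,λₘ).
Partition : Set
Partition = List ℕ

-- Subsets of {1,…,n}: Subset n, where position i : Fin n stands for the number suc (toℕ i).
_∈ₛ_ : {n : ℕ} → ℕ → Subset n → Set
_∈ₛ_ {n} x S = Σ (Fin n) (λ i → (suc (toℕ i) ≡ x) × (i ∈ S))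

elemsDesc : {n : ℕ} → Subset n → List ℕ
elemsDesc {n} S = reverse (map (λ i → suc (toℕ i)) (filter (λ i → i ∈? S) (allFin n)))

-- λ_A : the partition whose β-set is A.  If b₁ > … > bₘ are the elements of A,
-- then λᵢ = bᵢ − (m − i)  (inverse of β(λ) = {λᵢ + m − i}).
lam : {n : ℕ} → Subset n → Partition
lam S = zipWith (λ i b → b ∸ (m ∸ i)) (applyUpTo suc m) bs
  where
  bs = elemsDesc S
  m  = length bs

colLen : Partition → ℕ → ℕ
colLen p j = length (filter (λ x → j ≤? x) p)

firstPart : Partition → ℕ
firstPart []      = 0
firstPart (x ∷ _) = x

conj : Partition → Partition
conj p = applyUpTo (λ k → colLen p (suc k)) (firstPart p)

-- list of hook lengths of all boxes (i,j), 1 ≤ i ≤ m, 1 ≤ j ≤ λᵢ: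
-- hook(i,j) = (λᵢ − j) + (λ'_j − i) + 1.  Hook multiset = this list up to permutation.
hooks : Partition → List ℕ
hooks p = concat (zipWith (λ i r → map (λ j → (r ∸ j) + (colLen p j ∸ i) + 1) (applyUpTo suc r))
                          (applyUpTo suc (length p)) p)

Symmetric : (n : ℕ) → Subset n → Set
Symmetric n S = (x : ℕ) → (x ∈ₛ S) ⇔ Σ ℕ (λ y → (y ∈ₛ S) × (x ≡ n ∸ y))

module Submission where

-- Encode A ⊆ {1,…,n} by its membership predicate a on ℕ.  Listing A decreasingly,
-- the part of λ_A at the member b is the number of gaps (non-members) below b, and:
--   * conjugation: if n ∈ A then λ_A' = λ_{A*} with A* = {n} ∪ {n − x : x < n, x ∉ A}
--     (module Conjugate); moreover λ_A determines A (lam-injective);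
--   * hooks: the hooks of λ_A are the numbers b − x with b ∈ A, x ∉ A, x < b (module
--     Hooks), so the multiplicity of k ≥ 1 is the pair count #{(v, w) : v ∈ A, w ∉ A,
--     v = w + k} (hook-multiplicity).
-- Pair counts are additive in both predicates and transform under v ↦ n − v.  If
-- λ_B = λ_A' then B = A*, and the differences A ∖ A*, A* ∖ A are visibly
-- n-symmetric.  Conversely, with symmetric differences the equal pair counts of A
-- and B force, by induction below the largest element of A △ B, that B = A*
-- (module Reconstruction).

open import Defs
open import Data.Nat using (ℕ; zero; suc; _+_; _*_; _∸_; _≤_; _<_; z≤n; s≤s; _≤ᵇ_; _≡ᵇ_; _≤?_; _≟_)
open import Data.Nat.Properties
open import Data.Nat.Solver using (module +-*-Solver)
open import Data.Nat.Induction using (<-rec)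
open import Data.Bool using (Bool; true; false; _∧_; _∨_; not; T; T?)
open import Data.Bool.Properties using (∧-zeroʳ; ∧-identityʳ; ∧-comm; ∨-zeroʳ; not-involutive; T-≡)
open import Data.Fin using (Fin; toℕ) renaming (zero to fzero; suc to fsuc)
open import Data.Fin.Properties using (toℕ<n)
open import Data.Fin.Subset using (Subset; _─_; _∈_)
open import Data.Fin.Subset.Properties using (_∈?_)
open import Data.Vec using ([]; _∷_; here; there; tabulate)
import Data.List as List
open import Data.List
  using (List; []; _∷_; length; filter; filterᵇ; map; concat; zipWith; applyUpTo; applyDownFrom; upTo; downFrom;
         reverse; allFin; _++_)
open import Data.List.Properties
  using (length-filter; length-applyDownFrom; map-tabulate; map-upTo; map-applyUpTo; map-applyDownFrom; map-∘; map-++;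
         length-map; length-++; unfold-reverse; reverse-map; reverse-upTo; upTo-∷ʳ; applyUpTo-∷ʳ; ++-identityʳ; ∷-injective)
open import Data.List.Relation.Unary.All using (All; []; _∷_)
open import Data.List.Relation.Unary.All.Properties using (applyUpTo⁺₁)
open import Data.List.Relation.Binary.Permutation.Propositional using (_↭_)
open import Data.List.Relation.Binary.Permutation.Propositional.Properties using (↭-length; filter-↭)
open import Data.Product using (Σ; _×_; _,_; proj₁; proj₂)
open import Data.Sum using (_⊎_; inj₁; inj₂)
open import Data.Empty using (⊥-elim)
open import Function using (_∘_)
open import Function.Bundles using (_⇔_; mk⇔; Equivalence)
open import Relation.Binary using (tri<; tri≈; tri>)
open import Relation.Binary.PropositionalEquality
open import Relation.Nullary using (¬_; Dec; yes; no; does)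
open +-*-Solver using (solve; _:+_; _:=_; con)

sumBelow : (ℕ → ℕ) → ℕ → ℕ
sumBelow f zero    = 0
sumBelow f (suc N) = sumBelow f N + f N

+-interchange : ∀ a b c d → a + b + (c + d) ≡ a + c + (b + d)
+-interchange = solve 4 (λ a b c d → a :+ b :+ (c :+ d) := a :+ c :+ (b :+ d)) refl

+-rightComm : ∀ a b c → a + b + c ≡ a + c + b
+-rightComm = solve 3 (λ a b c → a :+ b :+ c := a :+ c :+ b) refl

sumBelow-cong : ∀ {f g : ℕ → ℕ} N → (∀ y → y < N → f y ≡ g y) → sumBelow f N ≡ sumBelow g N
sumBelow-cong zero    h = refl
sumBelow-cong (suc N) h = cong₂ _+_ (sumBelow-cong N (λ y y<N → h y (m<n⇒m<1+n y<N))) (h N ≤-refl)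

sumBelow-+ : ∀ (f g : ℕ → ℕ) N → sumBelow (λ y → f y + g y) N ≡ sumBelow f N + sumBelow g N
sumBelow-+ f g zero    = refl
sumBelow-+ f g (suc N) =
  trans (cong (_+ (f N + g N)) (sumBelow-+ f g N)) (+-interchange (sumBelow f N) (sumBelow g N) (f N) (g N))

sumBelow-zeros : ∀ N → sumBelow (λ _ → 0) N ≡ 0
sumBelow-zeros zero    = refl
sumBelow-zeros (suc N) = trans (+-identityʳ _) (sumBelow-zeros N)

sumBelow-zeroTail : ∀ (f : ℕ → ℕ) N M → N ≤ M → (∀ y → N ≤ y → y < M → f y ≡ 0) → sumBelow f M ≡ sumBelow f N
sumBelow-zeroTail f N zero    z≤n  h = refl
sumBelow-zeroTail f N (suc M) N≤1+M h with m≤n⇒m<n∨m≡n N≤1+M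
... | inj₂ refl = refl
... | inj₁ (s≤s N≤M) = begin
    sumBelow f M + f M ≡⟨ cong (sumBelow f M +_) (h M N≤M ≤-refl) ⟩
    sumBelow f M + 0   ≡⟨ +-identityʳ _ ⟩
    sumBelow f M       ≡⟨ sumBelow-zeroTail f N M N≤M (λ y N≤y y<M → h y N≤y (m<n⇒m<1+n y<M)) ⟩
    sumBelow f N       ∎
  where open ≡-Reasoning

sumBelow-mono : ∀ (f : ℕ → ℕ) {N M} → N ≤ M → sumBelow f N ≤ sumBelow f M
sumBelow-mono f {N} {zero}  z≤n = ≤-refl
sumBelow-mono f {N} {suc M} N≤1+M with m≤n⇒m<n∨m≡n N≤1+M
... | inj₂ refl       = ≤-refl
... | inj₁ (s≤s N≤M) = ≤-trans (sumBelow-mono f N≤M) (m≤m+n (sumBelow f M) (f M))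

sumBelow-reflect : ∀ (f : ℕ → ℕ) N → sumBelow f N ≡ sumBelow (λ y → f (N ∸ suc y)) N
sumBelow-reflect f zero    = refl
sumBelow-reflect f (suc N) = begin
    sumBelow f N + f N                                  ≡⟨ cong (_+ f N) (sumBelow-reflect f N) ⟩
    sumBelow (λ y → f (N ∸ suc y)) N + f N              ≡⟨ +-comm _ (f N) ⟩
    f N + sumBelow (λ y → f (N ∸ suc y)) N              ≡⟨ sym (firstTerm (λ y → f (suc N ∸ suc y)) N) ⟩
    sumBelow (λ y → f (suc N ∸ suc y)) (suc N)          ∎
  where
  open ≡-Reasoning
  firstTerm : ∀ (g : ℕ → ℕ) M → sumBelow g (suc M) ≡ g 0 + sumBelow (g ∘ suc) M
  firstTerm g zero    = +-comm 0 (g 0)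
  firstTerm g (suc M) = trans (cong (_+ g (suc M)) (firstTerm g M)) (+-assoc (g 0) _ (g (suc M)))

sumBelow-swap : ∀ (f : ℕ → ℕ → ℕ) N M →
  sumBelow (λ v → sumBelow (f v) M) N ≡ sumBelow (λ w → sumBelow (λ v → f v w) N) M
sumBelow-swap f zero    M = sym (sumBelow-zeros M)
sumBelow-swap f (suc N) M =
  trans (cong (_+ sumBelow (f N) M) (sumBelow-swap f N M)) (sym (sumBelow-+ (λ w → sumBelow (λ v → f v w) N) (f N) M))

sumBelow-single : ∀ (f : ℕ → ℕ) N j → j < N → (∀ v → v < N → v ≢ j → f v ≡ 0) → sumBelow f N ≡ f j
sumBelow-single f (suc N) j j<1+N h with j ≟ N
... | yes refl = cong (_+ f j) (sumBelow-zeroTail f 0 j z≤n (λ v _ v<j → h v (m<n⇒m<1+n v<j) (<⇒≢ v<j)))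
... | no j≢N   = begin
    sumBelow f N + f N ≡⟨ cong (sumBelow f N +_) (h N ≤-refl (j≢N ∘ sym)) ⟩
    sumBelow f N + 0   ≡⟨ +-identityʳ _ ⟩
    sumBelow f N       ≡⟨ sumBelow-single f N j (≤∧≢⇒< (≤-pred j<1+N) j≢N) (λ v v<N → h v (m<n⇒m<1+n v<N)) ⟩
    f j                ∎
  where open ≡-Reasoning

sumBelow-differAt : ∀ (f g : ℕ → ℕ) N j → j < N → (∀ v → v < N → v ≢ j → f v ≡ g v) →
  sumBelow f N + g j ≡ sumBelow g N + f j
sumBelow-differAt f g (suc N) j j<1+N h with j ≟ N
... | yes refl = begin
    sumBelow f j + f j + g j
      ≡⟨ cong (λ s → s + f j + g j) (sumBelow-cong j (λ v v<j → h v (m<n⇒m<1+n v<j) (<⇒≢ v<j))) ⟩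
    sumBelow g j + f j + g j
      ≡⟨ +-rightComm _ (f j) (g j) ⟩
    sumBelow g j + g j + f j ∎
  where open ≡-Reasoning
... | no j≢N = begin
    sumBelow f N + f N + g j
      ≡⟨ cong (λ x → sumBelow f N + x + g j) (h N ≤-refl (j≢N ∘ sym)) ⟩
    sumBelow f N + g N + g j
      ≡⟨ +-rightComm _ (g N) (g j) ⟩
    sumBelow f N + g j + g N
      ≡⟨ cong (_+ g N) (sumBelow-differAt f g N j (≤∧≢⇒< (≤-pred j<1+N) j≢N) (λ v v<N → h v (m<n⇒m<1+n v<N))) ⟩
    sumBelow g N + f j + g N
      ≡⟨ +-rightComm _ (f j) (g N) ⟩
    sumBelow g N + g N + f j ∎
  where open ≡-Reasoning

χ : Bool → ℕ
χ true  = 1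
χ false = 0

χ-∧ : ∀ x y → χ (x ∧ y) ≡ χ x * χ y
χ-∧ true  y = sym (+-identityʳ (χ y))
χ-∧ false y = refl

χ-split : ∀ x y → χ x ≡ χ (x ∧ y) + χ (x ∧ not y)
χ-split true  true  = refl
χ-split true  false = refl
χ-split false y     = refl

χ-excludedMiddle : ∀ b → χ b + χ (not b) ≡ 1
χ-excludedMiddle true  = refl
χ-excludedMiddle false = refl

countBelow : (ℕ → Bool) → ℕ → ℕ
countBelow s = sumBelow (χ ∘ s)

gapsBelow : (ℕ → Bool) → ℕ → ℕ
gapsBelow s = countBelow (not ∘ s)

countBelow+gapsBelow : ∀ s x → countBelow s x + gapsBelow s x ≡ x
countBelow+gapsBelow s zero    = refl
countBelow+gapsBelow s (suc x) = begin
    countBelow s x + χ (s x) + (gapsBelow s x + χ (not (s x)))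
  ≡⟨ +-interchange (countBelow s x) (χ (s x)) _ _ ⟩
    countBelow s x + gapsBelow s x + (χ (s x) + χ (not (s x)))
  ≡⟨ cong₂ _+_ (countBelow+gapsBelow s x) (χ-excludedMiddle (s x)) ⟩
    x + 1
  ≡⟨ +-comm x 1 ⟩
    suc x
  ∎
  where open ≡-Reasoning

gapsBelow-suc : ∀ s x → s x ≡ false → gapsBelow s (suc x) ≡ suc (gapsBelow s x)
gapsBelow-suc s x sx≡false rewrite sx≡false = +-comm (gapsBelow s x) 1

T⇒true : ∀ {b} → T b → b ≡ true
T⇒true = Equivalence.to T-≡

¬T⇒false : ∀ {b} → ¬ T b → b ≡ false
¬T⇒false {false} _ = refl
¬T⇒false {true}  h = ⊥-elim (h _)

≡ᵇ-true : ∀ {m n} → m ≡ n → (m ≡ᵇ n) ≡ true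
≡ᵇ-true {m} {n} m≡n = T⇒true (≡⇒≡ᵇ m n m≡n)

≡ᵇ-false : ∀ {m n} → m ≢ n → (m ≡ᵇ n) ≡ false
≡ᵇ-false {m} {n} m≢n = ¬T⇒false (m≢n ∘ ≡ᵇ⇒≡ m n)

≡ᵇ-sound : ∀ {m n} → (m ≡ᵇ n) ≡ true → m ≡ n
≡ᵇ-sound {m} {n} e = ≡ᵇ⇒≡ m n (Equivalence.from T-≡ e)

≤ᵇ-true : ∀ {m n} → m ≤ n → (m ≤ᵇ n) ≡ true
≤ᵇ-true m≤n = T⇒true (≤⇒≤ᵇ m≤n)

≤ᵇ-false : ∀ {m n} → n < m → (m ≤ᵇ n) ≡ false
≤ᵇ-false {m} {n} n<m = ¬T⇒false (<⇒≱ n<m ∘ ≤ᵇ⇒≤ m n)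

bool-ext : ∀ {x y : Bool} → (x ≡ true → y ≡ true) → (y ≡ true → x ≡ true) → x ≡ y
bool-ext {true}  {true}  f g = refl
bool-ext {true}  {false} f g = sym (f refl)
bool-ext {false} {true}  f g = g refl
bool-ext {false} {false} f g = refl

-- Subsets of {1,…,n} as Boolean predicates on ℕ.

-- Membership of x in S (false at 0 and beyond n).
member : {n : ℕ} → Subset n → ℕ → Bool
member []      x             = false
member (b ∷ S) zero          = false
member (b ∷ S) (suc zero)    = b
member (b ∷ S) (suc (suc x)) = member S (suc x)

member-zero : ∀ {n} (S : Subset n) → member S 0 ≡ false
member-zero []      = refl
member-zero (b ∷ S) = refl

member-∈ : ∀ {n} (S : Subset n) (i : Fin n) → i ∈ S → member S (suc (toℕ i)) ≡ true
member-∈ (b ∷ S) fzero    here      = refl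
member-∈ (b ∷ S) (fsuc i) (there p) = member-∈ S i p

∈ₛ⇒member : ∀ {n} (S : Subset n) x → x ∈ₛ S → member S x ≡ true
∈ₛ⇒member S x (i , refl , i∈S) = member-∈ S i i∈S

member⇒∈ₛ : ∀ {n} (S : Subset n) x → member S x ≡ true → x ∈ₛ S
member⇒∈ₛ (true ∷ S) (suc zero) refl = fzero , refl , here
member⇒∈ₛ (b ∷ S) (suc (suc x)) e with member⇒∈ₛ S (suc x) e
... | i , refl , i∈S = fsuc i , refl , there i∈S

∈ₛ-bound : ∀ {n} (S : Subset n) x → x ∈ₛ S → x ≤ n
∈ₛ-bound S x (i , refl , _) = toℕ<n i

member-tabulate : ∀ {n} (h : ℕ → Bool) v → 1 ≤ v → v ≤ n → member {n} (tabulate (h ∘ suc ∘ toℕ)) v ≡ h v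
member-tabulate {suc n} h (suc zero)    _ _         = refl
member-tabulate {suc n} h (suc (suc v)) _ (s≤s v≤n) = member-tabulate {n} (h ∘ suc) (suc v) (s≤s z≤n) v≤n

member-ext : ∀ {n} (S T : Subset n) → (∀ v → 1 ≤ v → v ≤ n → member S v ≡ member T v) → S ≡ T
member-ext []      []      h = refl
member-ext (x ∷ S) (y ∷ T) h = cong₂ _∷_ (h 1 (s≤s z≤n) (s≤s z≤n))
  (member-ext S T (λ { (suc v) _ v<n → h (suc (suc v)) (s≤s z≤n) (s≤s v<n) }))

member-─ : ∀ {n} (A B : Subset n) x → member (A ─ B) x ≡ member A x ∧ not (member B x)
member-─ []      []          x             = refl
member-─ (a ∷ A) (b ∷ B)     zero          = refl
member-─ (a ∷ A) (true ∷ B)  (suc zero)    = sym (∧-zeroʳ a)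
member-─ (a ∷ A) (false ∷ B) (suc zero)    = sym (∧-identityʳ a)
member-─ (a ∷ A) (b ∷ B)     (suc (suc x)) = member-─ A B (suc x)

symmetric⇒member : ∀ n (S : Subset n) → Symmetric n S → ∀ v → v ≤ n → member S v ≡ member S (n ∸ v)
symmetric⇒member n S sym-S v v≤n = bool-ext to from
  where
  to : member S v ≡ true → member S (n ∸ v) ≡ true
  to e with Equivalence.to (sym-S v) (member⇒∈ₛ S v e)
  ... | y , y∈S , refl = subst (λ z → member S z ≡ true) (sym (m∸[m∸n]≡n (∈ₛ-bound S y y∈S))) (∈ₛ⇒member S y y∈S)
  from : member S (n ∸ v) ≡ true → member S v ≡ true
  from e = ∈ₛ⇒member S v (Equivalence.from (sym-S v) (n ∸ v , member⇒∈ₛ S (n ∸ v) e , sym (m∸[m∸n]≡n v≤n)))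

member⇒symmetric : ∀ n (S : Subset n) → (∀ v → v ≤ n → member S v ≡ member S (n ∸ v)) → Symmetric n S
member⇒symmetric n S h x = mk⇔ to from
  where
  to : x ∈ₛ S → Σ ℕ (λ y → (y ∈ₛ S) × (x ≡ n ∸ y))
  to x∈S = n ∸ x , member⇒∈ₛ S (n ∸ x) (trans (sym (h x x≤n)) (∈ₛ⇒member S x x∈S)) , sym (m∸[m∸n]≡n x≤n)
    where x≤n = ∈ₛ-bound S x x∈S
  from : Σ ℕ (λ y → (y ∈ₛ S) × (x ≡ n ∸ y)) → x ∈ₛ S
  from (y , y∈S , refl) = member⇒∈ₛ S (n ∸ y) (trans (sym (h y (∈ₛ-bound S y y∈S))) (∈ₛ⇒member S y y∈S))

filter≡filterᵇ : {A : Set} {P : A → Set} (P? : ∀ x → Dec (P x)) (xs : List A) → filter P? xs ≡ filterᵇ (does ∘ P?) xs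
filter≡filterᵇ P? []       = refl
filter≡filterᵇ P? (x ∷ xs) with does (P? x)
... | true  = cong (x ∷_) (filter≡filterᵇ P? xs)
... | false = filter≡filterᵇ P? xs

filterᵇ-++ : {A : Set} (p : A → Bool) (xs ys : List A) → filterᵇ p (xs ++ ys) ≡ filterᵇ p xs ++ filterᵇ p ys
filterᵇ-++ p []       ys = refl
filterᵇ-++ p (x ∷ xs) ys with p x
... | true  = cong (x ∷_) (filterᵇ-++ p xs ys)
... | false = filterᵇ-++ p xs ys

filterᵇ-map : {A B : Set} (p : B → Bool) (f : A → B) (xs : List A) → filterᵇ p (map f xs) ≡ map f (filterᵇ (p ∘ f) xs)
filterᵇ-map p f []       = refl
filterᵇ-map p f (x ∷ xs) with p (f x)
... | true  = cong (f x ∷_) (filterᵇ-map p f xs)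
... | false = filterᵇ-map p f xs

filterᵇ-filterᵇ : {A : Set} (p q : A → Bool) (xs : List A) → filterᵇ q (filterᵇ p xs) ≡ filterᵇ (λ x → p x ∧ q x) xs
filterᵇ-filterᵇ p q []       = refl
filterᵇ-filterᵇ p q (x ∷ xs) with p x
... | false = filterᵇ-filterᵇ p q xs
... | true with q x
...   | true  = cong (x ∷_) (filterᵇ-filterᵇ p q xs)
...   | false = filterᵇ-filterᵇ p q xs

reverse-filterᵇ : {A : Set} (p : A → Bool) (xs : List A) → reverse (filterᵇ p xs) ≡ filterᵇ p (reverse xs)
reverse-filterᵇ p []       = refl
reverse-filterᵇ p (x ∷ xs) rewrite unfold-reverse x xs | filterᵇ-++ p (reverse xs) (x ∷ []) with p x
... | true  = trans (unfold-reverse x (filterᵇ p xs)) (cong (_++ (x ∷ [])) (reverse-filterᵇ p xs))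
... | false = trans (reverse-filterᵇ p xs) (sym (++-identityʳ _))

filterᵇ-cong : {A : Set} (p q : A → Bool) (xs : List A) → All (λ x → p x ≡ q x) xs → filterᵇ p xs ≡ filterᵇ q xs
filterᵇ-cong p q []       []                = refl
filterᵇ-cong p q (x ∷ xs) (px≡qx ∷ agree) with p x | q x | px≡qx
... | true  | true  | _ = cong (x ∷_) (filterᵇ-cong p q xs agree)
... | false | false | _ = filterᵇ-cong p q xs agree

length-filterᵇ-upTo : ∀ (s : ℕ → Bool) N → length (filterᵇ s (upTo N)) ≡ countBelow s N
length-filterᵇ-upTo s zero    = refl
length-filterᵇ-upTo s (suc N) = begin
    length (filterᵇ s (upTo (suc N)))
      ≡⟨ cong (length ∘ filterᵇ s) (sym (upTo-∷ʳ N)) ⟩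
    length (filterᵇ s (upTo N ++ (N ∷ [])))
      ≡⟨ cong length (filterᵇ-++ s (upTo N) (N ∷ [])) ⟩
    length (filterᵇ s (upTo N) ++ filterᵇ s (N ∷ []))
      ≡⟨ length-++ (filterᵇ s (upTo N)) ⟩
    length (filterᵇ s (upTo N)) + length (filterᵇ s (N ∷ []))
      ≡⟨ cong₂ _+_ (length-filterᵇ-upTo s N) (lastTerm (s N) refl) ⟩
    countBelow s (suc N)                              ∎
  where
  open ≡-Reasoning
  lastTerm : ∀ b → s N ≡ b → length (filterᵇ s (N ∷ [])) ≡ χ b
  lastTerm true  sN rewrite sN = refl
  lastTerm false sN rewrite sN = refl

-- Enumerating the members of p below N in increasing order: the member x is the
-- (countBelow p x)-th one, so any h factoring through that rank lists as applyUpTo.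
map-filterᵇ-upTo : ∀ (p : ℕ → Bool) (h F : ℕ → ℕ) N → (∀ x → x < N → p x ≡ true → h x ≡ F (countBelow p x)) →
  map h (filterᵇ p (upTo N)) ≡ applyUpTo F (countBelow p N)
map-filterᵇ-upTo p h F zero    H = refl
map-filterᵇ-upTo p h F (suc N) H = begin
    map h (filterᵇ p (upTo (suc N)))
      ≡⟨ cong (map h ∘ filterᵇ p) (sym (upTo-∷ʳ N)) ⟩
    map h (filterᵇ p (upTo N ++ (N ∷ [])))
      ≡⟨ cong (map h) (filterᵇ-++ p (upTo N) (N ∷ [])) ⟩
    map h (filterᵇ p (upTo N) ++ filterᵇ p (N ∷ []))
      ≡⟨ map-++ h (filterᵇ p (upTo N)) _ ⟩
    map h (filterᵇ p (upTo N)) ++ map h (filterᵇ p (N ∷ []))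
      ≡⟨ cong (_++ _) (map-filterᵇ-upTo p h F N (λ x x<N → H x (m<n⇒m<1+n x<N))) ⟩
    applyUpTo F (countBelow p N) ++ map h (filterᵇ p (N ∷ []))
      ≡⟨ lastTerm (p N) refl ⟩
    applyUpTo F (countBelow p (suc N))                         ∎
  where
  open ≡-Reasoning
  lastTerm : ∀ b → p N ≡ b → applyUpTo F (countBelow p N) ++ map h (filterᵇ p (N ∷ [])) ≡ applyUpTo F (countBelow p N + χ b)
  lastTerm true  pN rewrite pN | H N ≤-refl pN | +-comm (countBelow p N) 1 = applyUpTo-∷ʳ F (countBelow p N)
  lastTerm false pN rewrite pN | +-identityʳ (countBelow p N) = ++-identityʳ _

downTo1 : ℕ → List ℕ
downTo1 = applyDownFrom suc

elemsAsc : ∀ {n} (S : Subset n) →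
  map (suc ∘ toℕ) (filterᵇ (does ∘ (_∈? S)) (allFin n)) ≡ map suc (filterᵇ (member S ∘ suc) (upTo n))
elemsAscTail : ∀ {n} b (S : Subset n) →
  map (suc ∘ toℕ) (filterᵇ (does ∘ (_∈? b ∷ S)) (List.tabulate fsuc)) ≡
  map suc (filterᵇ (member (b ∷ S) ∘ suc) (applyUpTo suc n))
elemsAsc {zero} [] = refl
elemsAsc {suc n} (true  ∷ S) = cong (1 ∷_) (elemsAscTail true S)
elemsAsc {suc n} (false ∷ S) = elemsAscTail false S
elemsAscTail {n} b S = begin
    map (suc ∘ toℕ) (filterᵇ (does ∘ (_∈? b ∷ S)) (List.tabulate fsuc))
      ≡⟨ cong (map (suc ∘ toℕ) ∘ filterᵇ (does ∘ (_∈? b ∷ S))) (sym (map-tabulate (λ i → i) fsuc)) ⟩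
    map (suc ∘ toℕ) (filterᵇ (does ∘ (_∈? b ∷ S)) (map fsuc (allFin n)))
      ≡⟨ cong (map (suc ∘ toℕ)) (filterᵇ-map (does ∘ (_∈? b ∷ S)) fsuc (allFin n)) ⟩
    map (suc ∘ toℕ) (map fsuc (filterᵇ (does ∘ (_∈? S)) (allFin n)))
      ≡⟨ sym (map-∘ _) ⟩
    map (suc ∘ suc ∘ toℕ) (filterᵇ (does ∘ (_∈? S)) (allFin n))
      ≡⟨ map-∘ _ ⟩
    map suc (map (suc ∘ toℕ) (filterᵇ (does ∘ (_∈? S)) (allFin n)))
      ≡⟨ cong (map suc) (elemsAsc S) ⟩
    map suc (map suc (filterᵇ (member S ∘ suc) (upTo n)))
      ≡⟨ cong (map suc) (sym (filterᵇ-map (member (b ∷ S) ∘ suc) suc (upTo n))) ⟩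
    map suc (filterᵇ (member (b ∷ S) ∘ suc) (map suc (upTo n)))
      ≡⟨ cong (map suc ∘ filterᵇ (member (b ∷ S) ∘ suc)) (map-upTo suc n) ⟩
    map suc (filterᵇ (member (b ∷ S) ∘ suc) (applyUpTo suc n))               ∎
  where open ≡-Reasoning

elemsDesc≡filterᵇ : ∀ {n} (S : Subset n) → elemsDesc S ≡ filterᵇ (member S) (downTo1 n)
elemsDesc≡filterᵇ {n} S = begin
    reverse (map (suc ∘ toℕ) (filter (_∈? S) (allFin n)))
      ≡⟨ cong (reverse ∘ map (suc ∘ toℕ)) (filter≡filterᵇ (_∈? S) (allFin n)) ⟩
    reverse (map (suc ∘ toℕ) (filterᵇ (does ∘ (_∈? S)) (allFin n)))
      ≡⟨ cong reverse (elemsAsc S) ⟩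
    reverse (map suc (filterᵇ (member S ∘ suc) (upTo n)))
      ≡⟨ sym (reverse-map suc (filterᵇ (member S ∘ suc) (upTo n))) ⟩
    map suc (reverse (filterᵇ (member S ∘ suc) (upTo n)))
      ≡⟨ cong (map suc) (reverse-filterᵇ (member S ∘ suc) (upTo n)) ⟩
    map suc (filterᵇ (member S ∘ suc) (reverse (upTo n)))
      ≡⟨ cong (map suc ∘ filterᵇ (member S ∘ suc)) (reverse-upTo n) ⟩
    map suc (filterᵇ (member S ∘ suc) (downFrom n))
      ≡⟨ sym (filterᵇ-map (member S) suc (downFrom n)) ⟩
    filterᵇ (member S) (map suc (downFrom n))
      ≡⟨ cong (filterᵇ (member S)) (map-applyDownFrom (λ i → i) suc n) ⟩
    filterᵇ (member S) (downTo1 n)                                   ∎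
  where open ≡-Reasoning

-- Lower each entry by the number of entries after it: (b₁,…,bₘ) ↦ (bᵢ − (m − i)).
-- This is the passage from a decreasing β-list to its partition.
lowerByRank : List ℕ → List ℕ
lowerByRank []      = []
lowerByRank (b ∷ L) = (b ∸ length L) ∷ lowerByRank L

raiseByRank : List ℕ → List ℕ
raiseByRank []      = []
raiseByRank (b ∷ L) = (b + length L) ∷ raiseByRank L

length-lowerByRank : ∀ L → length (lowerByRank L) ≡ length L
length-lowerByRank []      = refl
length-lowerByRank (b ∷ L) = cong suc (length-lowerByRank L)

-- The zipWith in the definition of lam computes lowerByRank (c counts the entries already consumed).
zipWith≡lowerByRank : ∀ (L : List ℕ) c M (f : ℕ → ℕ) → (∀ i → f i ≡ suc (c + i)) → M ≡ c + length L →
  zipWith (λ i b → b ∸ (M ∸ i)) (applyUpTo f (length L)) L ≡ lowerByRank L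
zipWith≡lowerByRank []      c M f hf hM = refl
zipWith≡lowerByRank (b ∷ L) c M f hf hM =
  cong₂ _∷_ (cong (b ∸_) remaining)
            (zipWith≡lowerByRank L (suc c) M (f ∘ suc) (λ i → trans (hf (suc i)) (cong suc (+-suc c i)))
                                 (trans hM (+-suc c (length L))))
  where
  remaining : M ∸ f 0 ≡ length L
  remaining rewrite hf 0 | hM | +-identityʳ c | +-suc c (length L) = m+n∸m≡n (suc c) (length L)

length-filterᵇ-downTo1 : ∀ (s : ℕ → Bool) → s 0 ≡ false → ∀ k → length (filterᵇ s (downTo1 k)) ≡ countBelow s (suc k)
length-filterᵇ-downTo1 s s0 zero rewrite s0 = refl
length-filterᵇ-downTo1 s s0 (suc k) with s (suc k)
... | true  = trans (cong suc (length-filterᵇ-downTo1 s s0 k)) (+-comm 1 _)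
... | false = trans (length-filterᵇ-downTo1 s s0 k) (sym (+-identityʳ _))

lowerByRank≡gaps : ∀ (s : ℕ → Bool) → s 0 ≡ false → ∀ k →
  lowerByRank (filterᵇ s (downTo1 k)) ≡ map (gapsBelow s) (filterᵇ s (downTo1 k))
lowerByRank≡gaps s s0 zero = refl
lowerByRank≡gaps s s0 (suc k) with s (suc k)
... | false = lowerByRank≡gaps s s0 k
... | true  = cong₂ _∷_ head (lowerByRank≡gaps s s0 k)
  where
  head : suc k ∸ length (filterᵇ s (downTo1 k)) ≡ gapsBelow s (suc k)
  head rewrite length-filterᵇ-downTo1 s s0 k =
    trans (cong (_∸ countBelow s (suc k)) (sym (countBelow+gapsBelow s (suc k)))) (m+n∸m≡n (countBelow s (suc k)) _)

lam≡lowerByRank : ∀ {n} (S : Subset n) → lam S ≡ lowerByRank (filterᵇ (member S) (downTo1 n))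
lam≡lowerByRank S =
  trans (zipWith≡lowerByRank (elemsDesc S) 0 (length (elemsDesc S)) suc (λ i → refl) refl)
        (cong lowerByRank (elemsDesc≡filterᵇ S))

lam≡gaps : ∀ {n} (S : Subset n) → lam S ≡ map (gapsBelow (member S)) (filterᵇ (member S) (downTo1 n))
lam≡gaps {n} S = trans (lam≡lowerByRank S) (lowerByRank≡gaps (member S) (member-zero S) n)

raiseByRank∘lowerByRank : ∀ (s : ℕ → Bool) k → raiseByRank (lowerByRank (filterᵇ s (downTo1 k))) ≡ filterᵇ s (downTo1 k)
raiseByRank∘lowerByRank s zero = refl
raiseByRank∘lowerByRank s (suc k) with s (suc k)
... | false = raiseByRank∘lowerByRank s k
... | true  = cong₂ _∷_ head (raiseByRank∘lowerByRank s k)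
  where
  rest : List ℕ
  rest = filterᵇ s (downTo1 k)
  rest≤k : length rest ≤ k
  rest≤k = ≤-trans (length-filter (T? ∘ s) (downTo1 k)) (≤-reflexive (length-applyDownFrom suc k))
  head : suc k ∸ length rest + length (lowerByRank rest) ≡ suc k
  head rewrite length-lowerByRank rest = m∸n+n≡m (m≤n⇒m≤1+n rest≤k)

filterᵇ-downTo1-head≤ : ∀ (p : ℕ → Bool) k {x l} → filterᵇ p (downTo1 k) ≡ x ∷ l → x ≤ k
filterᵇ-downTo1-head≤ p (suc k) e with p (suc k)
... | true  = ≤-reflexive (sym (proj₁ (∷-injective e)))
... | false = m≤n⇒m≤1+n (filterᵇ-downTo1-head≤ p k e)

filterᵇ-downTo1-step : ∀ (s t : ℕ → Bool) k → filterᵇ s (downTo1 (suc k)) ≡ filterᵇ t (downTo1 (suc k)) →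
  s (suc k) ≡ t (suc k) × filterᵇ s (downTo1 k) ≡ filterᵇ t (downTo1 k)
filterᵇ-downTo1-step s t k e with s (suc k) | t (suc k)
... | true  | true  = refl , proj₂ (∷-injective e)
... | false | false = refl , e
... | true  | false = ⊥-elim (1+n≰n (filterᵇ-downTo1-head≤ t k (sym e)))
... | false | true  = ⊥-elim (1+n≰n (filterᵇ-downTo1-head≤ s k e))

filterᵇ-downTo1-injective : ∀ (s t : ℕ → Bool) k → filterᵇ s (downTo1 k) ≡ filterᵇ t (downTo1 k) →
  ∀ v → 1 ≤ v → v ≤ k → s v ≡ t v
filterᵇ-downTo1-injective s t zero    e (suc v) _ ()
filterᵇ-downTo1-injective s t (suc k) e v 1≤v v≤1+k with m≤n⇒m<n∨m≡n v≤1+k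
... | inj₂ refl  = proj₁ (filterᵇ-downTo1-step s t k e)
... | inj₁ v<1+k = filterᵇ-downTo1-injective s t k (proj₂ (filterᵇ-downTo1-step s t k e)) v 1≤v (≤-pred v<1+k)

lam-injective : ∀ {n} (S T : Subset n) → lam S ≡ lam T → S ≡ T
lam-injective {n} S T e = member-ext S T (filterᵇ-downTo1-injective (member S) (member T) n listsEqual)
  where
  membersFromLam : ∀ (U : Subset n) → filterᵇ (member U) (downTo1 n) ≡ raiseByRank (lam U)
  membersFromLam U = trans (sym (raiseByRank∘lowerByRank (member U) n)) (cong raiseByRank (sym (lam≡lowerByRank U)))
  listsEqual : filterᵇ (member S) (downTo1 n) ≡ filterᵇ (member T) (downTo1 n)
  listsEqual = trans (membersFromLam S) (trans (cong raiseByRank e) (sym (membersFromLam T)))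

-- Conjugation.  For A ⊆ {1,…,n} with n ∈ A, the conjugate of λ_A is λ_{A*} with
--   A* = {n} ∪ {n − x : 0 ≤ x < n, x ∉ A}.

conjugateTest : {n : ℕ} → ℕ → Subset n → ℕ → Bool
conjugateTest n A v = (v ≡ᵇ n) ∨ not (member A (n ∸ v))

conjugateSet : (n : ℕ) → Subset n → Subset n
conjugateSet n A = tabulate (conjugateTest n A ∘ suc ∘ toℕ)

module Conjugate (n′ : ℕ) (A : Subset (suc n′)) (n∈A : member A (suc n′) ≡ true) where

  n : ℕ
  n = suc n′

  a : ℕ → Bool
  a = member A

  gap : ℕ → ℕ
  gap = gapsBelow a

  members : List ℕ
  members = filterᵇ a (downTo1 n)

  A* : Subset n
  A* = conjugateSet n A

  a* : ℕ → Bool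
  a* = member A*

  membersAbove : ℕ → ℕ
  membersAbove x = sumBelow (λ v → χ (a v ∧ (suc x ≤ᵇ v))) (suc n)

  lam-A : lam A ≡ map gap members
  lam-A = lam≡gaps A

  gap-order : ∀ x → a x ≡ false → ∀ v → (a v ∧ (suc (gap x) ≤ᵇ gap v)) ≡ (a v ∧ (suc x ≤ᵇ v))
  gap-order x ax v with a v in av | <-cmp v x
  ... | false | _ = refl
  ... | true | tri≈ _ refl _ = ⊥-elim (true≢false (trans (sym av) ax))
    where true≢false : true ≢ false
          true≢false ()
  ... | true | tri< v<x _ _ = trans (≤ᵇ-false (s≤s (sumBelow-mono _ (<⇒≤ v<x)))) (sym (≤ᵇ-false (s≤s (<⇒≤ v<x))))
  ... | true | tri> _ _ x<v =
    trans (≤ᵇ-true (subst (_≤ gap v) (gapsBelow-suc a x ax) (sumBelow-mono _ x<v))) (sym (≤ᵇ-true x<v))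

  colLen-gap : ∀ x → a x ≡ false → colLen (map gap members) (suc (gap x)) ≡ membersAbove x
  colLen-gap x ax = begin
      length (filter (suc (gap x) ≤?_) (map gap members))
        ≡⟨ cong length (filter≡filterᵇ (suc (gap x) ≤?_) (map gap members)) ⟩
      length (filterᵇ (suc (gap x) ≤ᵇ_) (map gap members))
        ≡⟨ cong length (filterᵇ-map (suc (gap x) ≤ᵇ_) gap members) ⟩
      length (map gap (filterᵇ (λ v → suc (gap x) ≤ᵇ gap v) members))
        ≡⟨ length-map gap (filterᵇ (λ v → suc (gap x) ≤ᵇ gap v) members) ⟩
      length (filterᵇ (λ v → suc (gap x) ≤ᵇ gap v) members)
        ≡⟨ cong length (filterᵇ-filterᵇ a (λ v → suc (gap x) ≤ᵇ gap v) (downTo1 n)) ⟩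
      length (filterᵇ (λ v → a v ∧ (suc (gap x) ≤ᵇ gap v)) (downTo1 n))
        ≡⟨ length-filterᵇ-downTo1 _ (cong (_∧ _) (member-zero A)) n ⟩
      sumBelow (λ v → χ (a v ∧ (suc (gap x) ≤ᵇ gap v))) (suc n)
        ≡⟨ sumBelow-cong (suc n) (λ v _ → cong χ (gap-order x ax v)) ⟩
      membersAbove x                                               ∎
    where open ≡-Reasoning

  a*-reflect : ∀ x → x < n → a* (n ∸ x) ≡ not (a x)
  a*-reflect x x<n = trans (member-tabulate (conjugateTest n A) (n ∸ x) (m<n⇒0<n∸m x<n) (m∸n≤m n x)) (test x x<n)
    where
    test : ∀ x → x < n → conjugateTest n A (n ∸ x) ≡ not (a x)
    test zero    _     rewrite ≡ᵇ-true {n} refl | member-zero A = refl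
    test (suc x) 1+x<n rewrite ≡ᵇ-false {n ∸ suc x} {n} (<⇒≢ (∸-monoʳ-< {n} {suc x} {0} (s≤s z≤n) (<⇒≤ 1+x<n)))
                             | m∸[m∸n]≡n (<⇒≤ 1+x<n) = refl

  not-a* : ∀ y → y < n → not (a* y) ≡ a (n ∸ y)
  not-a* zero    _     rewrite member-zero A* = sym n∈A
  not-a* (suc y) 1+y<n rewrite member-tabulate (conjugateTest n A) (suc y) (s≤s z≤n) (<⇒≤ 1+y<n)
                             | ≡ᵇ-false {suc y} {n} (<⇒≢ 1+y<n) = not-involutive _

  gap*-reflect : ∀ x → x < n → gapsBelow a* (n ∸ x) ≡ membersAbove x
  gap*-reflect x x<n = begin
      sumBelow (λ y → χ (not (a* y))) (n ∸ x)
        ≡⟨ sumBelow-cong (n ∸ x) (λ y y<n-x → cong χ (not-a* y (<-≤-trans y<n-x (m∸n≤m n x)))) ⟩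
      sumBelow (λ y → χ (a (n ∸ y))) (n ∸ x)
        ≡⟨ sumBelow-cong (n ∸ x) keptTerm ⟩
      sumBelow (λ y → χ (a (n ∸ y) ∧ (suc x ≤ᵇ (n ∸ y)))) (n ∸ x)
        ≡⟨ sym (sumBelow-zeroTail _ (n ∸ x) (suc n) (m≤n⇒m≤1+n (m∸n≤m n x))
                 (λ y n-x≤y _ → droppedTerm y n-x≤y)) ⟩
      sumBelow (λ y → χ (a (n ∸ y) ∧ (suc x ≤ᵇ (n ∸ y)))) (suc n)
        ≡⟨ sym (sumBelow-reflect (λ v → χ (a v ∧ (suc x ≤ᵇ v))) (suc n)) ⟩
      membersAbove x
        ∎
    where
    open ≡-Reasoning
    above : ∀ y → y < n ∸ x → x < n ∸ y
    above y y<n-x = subst (_< n ∸ y) (m∸[m∸n]≡n (<⇒≤ x<n)) (∸-monoʳ-< y<n-x (m∸n≤m n x))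
    notAbove : ∀ y → n ∸ x ≤ y → n ∸ y ≤ x
    notAbove y n-x≤y = subst (n ∸ y ≤_) (m∸[m∸n]≡n (<⇒≤ x<n)) (∸-monoʳ-≤ n n-x≤y)
    keptTerm : ∀ y → y < n ∸ x → χ (a (n ∸ y)) ≡ χ (a (n ∸ y) ∧ (suc x ≤ᵇ (n ∸ y)))
    keptTerm y y<n-x rewrite ≤ᵇ-true (above y y<n-x) = cong χ (sym (∧-identityʳ _))
    droppedTerm : ∀ y → n ∸ x ≤ y → χ (a (n ∸ y) ∧ (suc x ≤ᵇ (n ∸ y))) ≡ 0
    droppedTerm y n-x≤y rewrite ≤ᵇ-false (s≤s (notAbove y n-x≤y)) = cong χ (∧-zeroʳ _)

  members* : filterᵇ a* (downTo1 n) ≡ map (n ∸_) (filterᵇ (not ∘ a) (upTo n))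
  members* = begin
      filterᵇ a* (downTo1 n)
        ≡⟨ cong (filterᵇ a*) (downTo1≡reflectedUpTo n) ⟩
      filterᵇ a* (map (n ∸_) (upTo n))
        ≡⟨ filterᵇ-map a* (n ∸_) (upTo n) ⟩
      map (n ∸_) (filterᵇ (a* ∘ (n ∸_)) (upTo n))
        ≡⟨ cong (map (n ∸_)) (filterᵇ-cong _ _ (upTo n) (applyUpTo⁺₁ (λ i → i) n (a*-reflect _))) ⟩
      map (n ∸_) (filterᵇ (not ∘ a) (upTo n))       ∎
    where
    open ≡-Reasoning
    downTo1≡reflectedUpTo : ∀ n → downTo1 n ≡ map (n ∸_) (upTo n)
    downTo1≡reflectedUpTo zero    = refl
    downTo1≡reflectedUpTo (suc n) = cong (suc n ∷_)
      (trans (downTo1≡reflectedUpTo n) (trans (map-upTo (n ∸_) n) (sym (map-applyUpTo suc (suc n ∸_) n))))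

  conj-lam : conj (lam A) ≡ lam A*
  conj-lam = begin
      conj (lam A)
        ≡⟨ cong conj lam-A ⟩
      applyUpTo column (firstPart (map gap members))
        ≡⟨ cong (λ l → applyUpTo column (firstPart (map gap l))) largestMember ⟩
      applyUpTo column (gap n)
        ≡⟨ sym (map-filterᵇ-upTo (not ∘ a) (gapsBelow a* ∘ (n ∸_)) column n columnAtGap) ⟩
      map (gapsBelow a* ∘ (n ∸_)) (filterᵇ (not ∘ a) (upTo n))
        ≡⟨ map-∘ _ ⟩
      map (gapsBelow a*) (map (n ∸_) (filterᵇ (not ∘ a) (upTo n)))
        ≡⟨ cong (map (gapsBelow a*)) (sym members*) ⟩
      map (gapsBelow a*) (filterᵇ a* (downTo1 n))
        ≡⟨ sym (lam≡gaps A*) ⟩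
      lam A*                                                            ∎
    where
    open ≡-Reasoning
    column : ℕ → ℕ
    column k = colLen (map gap members) (suc k)
    largestMember : members ≡ n ∷ filterᵇ a (downTo1 n′)
    largestMember rewrite n∈A = refl
    columnAtGap : ∀ x → x < n → not (a x) ≡ true → gapsBelow a* (n ∸ x) ≡ column (countBelow (not ∘ a) x)
    columnAtGap x x<n x∉A =
      trans (gap*-reflect x x<n) (sym (colLen-gap x (trans (sym (not-involutive (a x))) (cong not x∉A))))

  a*-inner : ∀ v → 1 ≤ v → v < n → a* v ≡ not (a (n ∸ v))
  a*-inner v 1≤v v<n = subst (λ z → a* z ≡ not (a (n ∸ v))) (m∸[m∸n]≡n (<⇒≤ v<n))
                         (a*-reflect (n ∸ v) (∸-monoʳ-< {n} {v} {0} 1≤v (<⇒≤ v<n)))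

  n∈A* : a* n ≡ true
  n∈A* rewrite member-tabulate (conjugateTest n A) n (s≤s z≤n) ≤-refl | ≡ᵇ-true {n} refl = refl

  -- The differences of A and A* are n-symmetric: inside (0, n) they are the sets
  -- {v : v, n − v ∈ A} and {v : v, n − v ∉ A}, and both avoid 0 and n.
  differences-symmetric : Symmetric n (A ─ A*) × Symmetric n (A* ─ A)
  differences-symmetric =
      member⇒symmetric n (A ─ A*) (reflect-invariant (member (A ─ A*)) atZero-─ atN-─ inner-─)
    , member⇒symmetric n (A* ─ A) (reflect-invariant (member (A* ─ A)) atZero-─′ atN-─′ inner-─′)
    where
    reflect-invariant : ∀ (f : ℕ → Bool) → f 0 ≡ false → f n ≡ false → (∀ v → 1 ≤ v → v < n → f v ≡ f (n ∸ v)) →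
      ∀ v → v ≤ n → f v ≡ f (n ∸ v)
    reflect-invariant f f0 fn inner zero    _      = trans f0 (sym fn)
    reflect-invariant f f0 fn inner (suc v) 1+v≤n with m≤n⇒m<n∨m≡n 1+v≤n
    ... | inj₁ 1+v<n = inner (suc v) (s≤s z≤n) 1+v<n
    ... | inj₂ refl rewrite n∸n≡0 n′ = trans fn (sym f0)
    atZero-─ : member (A ─ A*) 0 ≡ false
    atZero-─ = member-zero (A ─ A*)
    atZero-─′ : member (A* ─ A) 0 ≡ false
    atZero-─′ = member-zero (A* ─ A)
    atN-─ : member (A ─ A*) n ≡ false
    atN-─ rewrite member-─ A A* n | n∈A* = ∧-zeroʳ (a n)
    atN-─′ : member (A* ─ A) n ≡ false
    atN-─′ rewrite member-─ A* A n | n∈A = ∧-zeroʳ (a* n)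
    inner-─ : ∀ v → 1 ≤ v → v < n → member (A ─ A*) v ≡ member (A ─ A*) (n ∸ v)
    inner-─ v 1≤v v<n
      rewrite member-─ A A* v | member-─ A A* (n ∸ v) | a*-inner v 1≤v v<n | a*-reflect v v<n
            | not-involutive (a (n ∸ v)) | not-involutive (a v) = ∧-comm (a v) (a (n ∸ v))
    inner-─′ : ∀ v → 1 ≤ v → v < n → member (A* ─ A) v ≡ member (A* ─ A) (n ∸ v)
    inner-─′ v 1≤v v<n
      rewrite member-─ A* A v | member-─ A* A (n ∸ v) | a*-inner v 1≤v v<n | a*-reflect v v<n
      = ∧-comm (not (a (n ∸ v))) (not (a v))

-- Hook lengths.  The hooks in the row of λ_A belonging to the member b of A are
-- the numbers b − x for the gaps x < b of A.

-- The linear arithmetic behind a single hook: with P gaps and Q members strictly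
-- between the gap x and the member b (and c members above b), the hook is b − x.
hookArithmetic : ∀ {P Q gx c Kx m cx cb gb b x} → gb ≡ P + suc gx → Kx ≡ Q + suc c → Kx + cx ≡ m →
  c + suc cb ≡ m → cx + gx ≡ x → cb + gb ≡ b → P + Q + 1 + x ≡ b
hookArithmetic {P} {Q} {gx} {c} {Kx} {m} {cx} {cb} {gb} {b} {x} refl refl Kx+cx≡m c+1+cb≡m refl refl = begin
    P + Q + 1 + (cx + gx)
      ≡⟨ solve 4 (λ P Q cx gx → P :+ Q :+ con 1 :+ (cx :+ gx) := (Q :+ cx) :+ (P :+ (con 1 :+ gx))) refl P Q cx gx ⟩
    Q + cx + (P + suc gx)
      ≡⟨ cong (_+ (P + suc gx)) (sym membersBelowB) ⟩
    cb + (P + suc gx)       ∎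
  where
  open ≡-Reasoning
  membersBelowB : cb ≡ Q + cx
  membersBelowB = +-cancelˡ-≡ (suc c) cb (Q + cx) (begin
      suc c + cb
        ≡⟨ sym (+-suc c cb) ⟩
      c + suc cb
        ≡⟨ trans c+1+cb≡m (sym Kx+cx≡m) ⟩
      Q + suc c + cx
        ≡⟨ solve 3 (λ Q c cx → Q :+ (con 1 :+ c) :+ cx := con 1 :+ c :+ (Q :+ cx)) refl Q c cx ⟩
      suc c + (Q + cx)       ∎)

hookRow : (ℕ → Bool) → ℕ → List ℕ
hookRow s b = map (b ∸_) (filterᵇ (not ∘ s) (upTo b))

module Hooks (n′ : ℕ) (A : Subset (suc n′)) (n∈A : member A (suc n′) ≡ true) where
  open Conjugate n′ A n∈A

  m : ℕ
  m = countBelow a (suc n)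

  row : ℕ → ℕ → List ℕ
  row i r = map (λ j → (r ∸ j) + (colLen (map gap members) j ∸ i) + 1) (applyUpTo suc r)

  membersAbove+below : ∀ x → x ≤ n → membersAbove x + countBelow a (suc x) ≡ m
  membersAbove+below x x≤n = begin
      membersAbove x + countBelow a (suc x)
        ≡⟨ cong (membersAbove x +_) (sumBelow-cong (suc x) (λ v v≤x → cong χ (sym (belowTerm v v≤x)))) ⟩
      membersAbove x + sumBelow (λ v → χ (a v ∧ not (suc x ≤ᵇ v))) (suc x)
        ≡⟨ cong (membersAbove x +_) (sym (sumBelow-zeroTail _ (suc x) (suc n) (s≤s x≤n) (λ v x<v _ → cong χ (aboveTerm v x<v)))) ⟩
      membersAbove x + sumBelow (λ v → χ (a v ∧ not (suc x ≤ᵇ v))) (suc n)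
        ≡⟨ sym (sumBelow-+ (λ v → χ (a v ∧ (suc x ≤ᵇ v))) (λ v → χ (a v ∧ not (suc x ≤ᵇ v))) (suc n)) ⟩
      sumBelow (λ v → χ (a v ∧ (suc x ≤ᵇ v)) + χ (a v ∧ not (suc x ≤ᵇ v))) (suc n)
        ≡⟨ sumBelow-cong (suc n) (λ v _ → sym (χ-split (a v) (suc x ≤ᵇ v))) ⟩
      m ∎
    where
    open ≡-Reasoning
    belowTerm : ∀ v → v < suc x → (a v ∧ not (suc x ≤ᵇ v)) ≡ a v
    belowTerm v v≤x rewrite ≤ᵇ-false v≤x = ∧-identityʳ (a v)
    aboveTerm : ∀ v → suc x ≤ v → (a v ∧ not (suc x ≤ᵇ v)) ≡ false
    aboveTerm v x<v rewrite ≤ᵇ-true x<v = ∧-zeroʳ (a v)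

  row≡hookRow : ∀ b c → b ≤ n → a b ≡ true → c + countBelow a (suc b) ≡ m → row (suc c) (gap b) ≡ hookRow a b
  row≡hookRow b c b≤n b∈A c+below≡m =
    trans (map-applyUpTo suc _ (gap b))
          (sym (map-filterᵇ-upTo (not ∘ a) (b ∸_) (λ t → (gap b ∸ suc t) + (colLen (map gap members) (suc t) ∸ suc c) + 1) b hookAtGap))
    where
    below-b : countBelow a (suc b) ≡ suc (countBelow a b)
    below-b rewrite b∈A = +-comm (countBelow a b) 1
    c+1+cb≡m : c + suc (countBelow a b) ≡ m
    c+1+cb≡m = trans (cong (c +_) (sym below-b)) c+below≡m
    hookAtGap : ∀ x → x < b → not (a x) ≡ true →
      b ∸ x ≡ (gap b ∸ suc (gap x)) + (colLen (map gap members) (suc (gap x)) ∸ suc c) + 1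
    hookAtGap x x<b x∉A = trans (cong (_∸ x) (sym hook+x≡b)) (m+n∸n≡m _ x)
      where
      ax : a x ≡ false
      ax = trans (sym (not-involutive (a x))) (cong not x∉A)
      cx : ℕ
      cx = countBelow a (suc x)
      gap-x+1 : gap (suc x) ≡ suc (gap x)
      gap-x+1 = gapsBelow-suc a x ax
      x≤n : x ≤ n
      x≤n = ≤-trans (<⇒≤ x<b) b≤n
      gapsBetween : suc (gap x) ≤ gap b
      gapsBetween = subst (_≤ gap b) gap-x+1 (sumBelow-mono _ x<b)
      membersBetween : suc c ≤ membersAbove x
      membersBetween = +-cancelʳ-≤ cx (suc c) (membersAbove x) (begin
          suc c + cx               ≡⟨ sym (+-suc c cx) ⟩
          c + suc cx               ≤⟨ +-monoʳ-≤ c (s≤s (sumBelow-mono _ x<b)) ⟩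
          c + suc (countBelow a b) ≡⟨ c+1+cb≡m ⟩
          m                        ≡⟨ sym (membersAbove+below x x≤n) ⟩
          membersAbove x + cx      ∎)
        where open ≤-Reasoning
      hook+x≡b : (gap b ∸ suc (gap x)) + (colLen (map gap members) (suc (gap x)) ∸ suc c) + 1 + x ≡ b
      hook+x≡b rewrite colLen-gap x ax = hookArithmetic
        (sym (m∸n+n≡m gapsBetween)) (sym (m∸n+n≡m membersBetween)) (membersAbove+below x x≤n) c+1+cb≡m
        (suc-injective (trans (sym (+-suc cx (gap x))) (trans (cong (cx +_) (sym gap-x+1)) (countBelow+gapsBelow a (suc x)))))
        (countBelow+gapsBelow a b)

  -- The rows of the members ≤ k of A, given that c members lie above k (so these rows
  -- are numbered from c + 1 on, as produced by f).
  rows≡hookRows : ∀ k → k ≤ n → ∀ c (f : ℕ → ℕ) → (∀ i → f i ≡ suc (c + i)) → c + countBelow a (suc k) ≡ m →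
    zipWith row (applyUpTo f (length (map gap (filterᵇ a (downTo1 k))))) (map gap (filterᵇ a (downTo1 k)))
      ≡ map (hookRow a) (filterᵇ a (downTo1 k))
  rows≡hookRows zero    _     c f hf hc = refl
  rows≡hookRows (suc k) 1+k≤n c f hf hc with a (suc k) in k+1∈A
  ... | true  = cong₂ _∷_
      (trans (cong (λ i → row i (gap (suc k))) (trans (hf 0) (cong suc (+-identityʳ c))))
             (row≡hookRow (suc k) c 1+k≤n k+1∈A (subst (λ z → c + (countBelow a (suc k) + χ z) ≡ m) (sym k+1∈A) hc)))
      (rows≡hookRows k (≤-trans (n≤1+n k) 1+k≤n) (suc c) (f ∘ suc) (λ i → trans (hf (suc i)) (cong suc (+-suc c i)))
         (trans (sym (+-suc c (countBelow a (suc k)))) (trans (cong (c +_) (+-comm 1 (countBelow a (suc k)))) hc)))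
  ... | false = rows≡hookRows k (≤-trans (n≤1+n k) 1+k≤n) c f hf
                  (trans (cong (c +_) (sym (+-identityʳ (countBelow a (suc k))))) hc)

  hooks-lam : hooks (lam A) ≡ concat (map (hookRow a) members)
  hooks-lam = trans (cong hooks lam-A) (cong concat (rows≡hookRows n ≤-refl 0 suc (λ i → refl) refl))

-- Counting hooks.  For k ≥ 1 the multiplicity of k among the hooks of λ_A is the
-- number of pairs (v, w) with v ∈ A, w ∉ A and v = w + k.

multiplicity : ℕ → List ℕ → ℕ
multiplicity k L = length (filterᵇ (_≡ᵇ k) L)

-- Multiplicities are invariant under permutation, so they determine the hook multiset.
multiplicity-↭ : ∀ k {xs ys} → xs ↭ ys → multiplicity k xs ≡ multiplicity k ys
multiplicity-↭ k xs↭ys = ↭-length (filter-↭ (T? ∘ (_≡ᵇ k)) xs↭ys)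

multiplicity-++ : ∀ k xs ys → multiplicity k (xs ++ ys) ≡ multiplicity k xs + multiplicity k ys
multiplicity-++ k xs ys = trans (cong length (filterᵇ-++ (_≡ᵇ k) xs ys)) (length-++ (filterᵇ (_≡ᵇ k) xs))

multiplicity-concat : ∀ k (s : ℕ → Bool) (H : ℕ → List ℕ) (G : ℕ → ℕ) N → s 0 ≡ false → G 0 ≡ 0 →
  (∀ v → v ≤ N → s v ≡ true → multiplicity k (H v) ≡ G v) → (∀ v → v ≤ N → s v ≡ false → G v ≡ 0) →
  multiplicity k (concat (map H (filterᵇ s (downTo1 N)))) ≡ sumBelow G (suc N)
multiplicity-concat k s H G zero    s0 G0 onS offS = sym G0
multiplicity-concat k s H G (suc N) s0 G0 onS offS with s (suc N) in sN
... | true  = begin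
    multiplicity k (H (suc N) ++ concat (map H (filterᵇ s (downTo1 N))))
      ≡⟨ multiplicity-++ k (H (suc N)) _ ⟩
    multiplicity k (H (suc N)) + multiplicity k (concat (map H (filterᵇ s (downTo1 N))))
                                                                            ≡⟨ cong₂ _+_ (onS (suc N) ≤-refl sN) rest ⟩
    G (suc N) + sumBelow G (suc N)
      ≡⟨ +-comm (G (suc N)) _ ⟩
    sumBelow G (suc (suc N))                                                ∎
  where
  open ≡-Reasoning
  rest : multiplicity k (concat (map H (filterᵇ s (downTo1 N)))) ≡ sumBelow G (suc N)
  rest = multiplicity-concat k s H G N s0 G0 (λ v v≤N → onS v (m≤n⇒m≤1+n v≤N)) (λ v v≤N → offS v (m≤n⇒m≤1+n v≤N))
... | false = begin
    multiplicity k (concat (map H (filterᵇ s (downTo1 N))))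
      ≡⟨ multiplicity-concat k s H G N s0 G0 (λ v v≤N → onS v (m≤n⇒m≤1+n v≤N)) (λ v v≤N → offS v (m≤n⇒m≤1+n v≤N)) ⟩
    sumBelow G (suc N)
      ≡⟨ sym (+-identityʳ _) ⟩
    sumBelow G (suc N) + 0
      ≡⟨ cong (sumBelow G (suc N) +_) (sym (offS (suc N) ≤-refl sN)) ⟩
    sumBelow G (suc (suc N))                                ∎
  where open ≡-Reasoning

doubleSum : ℕ → (ℕ → ℕ → ℕ) → ℕ
doubleSum n F = sumBelow (λ v → sumBelow (F v) (suc n)) (suc n)

pairCount : ℕ → (ℕ → Bool) → (ℕ → Bool) → ℕ → ℕ
pairCount n S T k = doubleSum n (λ v w → χ (S v ∧ T w ∧ (v ≡ᵇ w + k)))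

∸≡ᵇ : ∀ v w k → w ≤ v → ((v ∸ w) ≡ᵇ k) ≡ (v ≡ᵇ w + k)
∸≡ᵇ v w k w≤v = bool-ext
  (λ e → ≡ᵇ-true (trans (sym (m∸n+n≡m w≤v)) (trans (cong (_+ w) (≡ᵇ-sound e)) (+-comm k w))))
  (λ e → ≡ᵇ-true (trans (cong (_∸ w) (≡ᵇ-sound e)) (m+n∸m≡n w k)))

hook-multiplicity : ∀ n′ (A : Subset (suc n′)) (n∈A : member A (suc n′) ≡ true) → ∀ k → 1 ≤ k →
  multiplicity k (hooks (lam A)) ≡ pairCount (suc n′) (member A) (not ∘ member A) k
hook-multiplicity n′ A n∈A k 1≤k =
  trans (cong (multiplicity k) hooks-lam)
        (multiplicity-concat k a (hookRow a) pairsFrom n (member-zero A) (notMember 0 z≤n (member-zero A)) rowCount notMember)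
  where
  open Conjugate n′ A n∈A
  open Hooks n′ A n∈A
  pairsFrom : ℕ → ℕ
  pairsFrom v = sumBelow (λ w → χ (a v ∧ not (a w) ∧ (v ≡ᵇ w + k))) (suc n)
  notMember : ∀ v → v ≤ n → a v ≡ false → pairsFrom v ≡ 0
  notMember v _ av rewrite av = sumBelow-zeros (suc n)
  rowCount : ∀ v → v ≤ n → a v ≡ true → multiplicity k (hookRow a v) ≡ pairsFrom v
  rowCount v v≤n av = begin
      length (filterᵇ (_≡ᵇ k) (map (v ∸_) (filterᵇ (not ∘ a) (upTo v))))
        ≡⟨ cong length (filterᵇ-map (_≡ᵇ k) (v ∸_) (filterᵇ (not ∘ a) (upTo v))) ⟩
      length (map (v ∸_) (filterᵇ (λ w → (v ∸ w) ≡ᵇ k) (filterᵇ (not ∘ a) (upTo v))))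
        ≡⟨ length-map (v ∸_) (filterᵇ (λ w → (v ∸ w) ≡ᵇ k) (filterᵇ (not ∘ a) (upTo v))) ⟩
      length (filterᵇ (λ w → (v ∸ w) ≡ᵇ k) (filterᵇ (not ∘ a) (upTo v)))
        ≡⟨ cong length (filterᵇ-filterᵇ (not ∘ a) (λ w → (v ∸ w) ≡ᵇ k) (upTo v)) ⟩
      length (filterᵇ (λ w → not (a w) ∧ ((v ∸ w) ≡ᵇ k)) (upTo v))
        ≡⟨ length-filterᵇ-upTo _ v ⟩
      sumBelow (λ w → χ (not (a w) ∧ ((v ∸ w) ≡ᵇ k))) v
        ≡⟨ sumBelow-cong v (λ w w<v → cong (λ t → χ (not (a w) ∧ t)) (∸≡ᵇ v w k (<⇒≤ w<v))) ⟩
      sumBelow (λ w → χ (not (a w) ∧ (v ≡ᵇ w + k))) v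
        ≡⟨ sym (sumBelow-zeroTail _ v (suc n) (m≤n⇒m≤1+n v≤n) (λ w v≤w _ → tooFar w v≤w)) ⟩
      sumBelow (λ w → χ (not (a w) ∧ (v ≡ᵇ w + k))) (suc n)
        ≡⟨ cong (λ t → sumBelow (λ w → χ (t ∧ not (a w) ∧ (v ≡ᵇ w + k))) (suc n)) (sym av) ⟩
      pairsFrom v ∎
    where
    open ≡-Reasoning
    tooFar : ∀ w → v ≤ w → χ (not (a w) ∧ (v ≡ᵇ w + k)) ≡ 0
    tooFar w v≤w rewrite ≡ᵇ-false {v} {w + k} (<⇒≢ (<-≤-trans (m<m+n v 1≤k) (+-monoˡ-≤ k v≤w))) = cong χ (∧-zeroʳ _)

χ-∧-splitˡ : ∀ {x} x₁ x₂ y → χ x ≡ χ x₁ + χ x₂ → χ (x ∧ y) ≡ χ (x₁ ∧ y) + χ (x₂ ∧ y)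
χ-∧-splitˡ {x} x₁ x₂ y split = begin
    χ (x ∧ y)                    ≡⟨ χ-∧ x y ⟩
    χ x * χ y                    ≡⟨ cong (_* χ y) split ⟩
    (χ x₁ + χ x₂) * χ y          ≡⟨ *-distribʳ-+ (χ y) (χ x₁) (χ x₂) ⟩
    χ x₁ * χ y + χ x₂ * χ y      ≡⟨ sym (cong₂ _+_ (χ-∧ x₁ y) (χ-∧ x₂ y)) ⟩
    χ (x₁ ∧ y) + χ (x₂ ∧ y)      ∎
  where open ≡-Reasoning

χ-∧-splitʳ : ∀ x {y} y₁ y₂ → χ y ≡ χ y₁ + χ y₂ → χ (x ∧ y) ≡ χ (x ∧ y₁) + χ (x ∧ y₂)
χ-∧-splitʳ x {y} y₁ y₂ split = begin
    χ (x ∧ y)                    ≡⟨ χ-∧ x y ⟩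
    χ x * χ y                    ≡⟨ cong (χ x *_) split ⟩
    χ x * (χ y₁ + χ y₂)          ≡⟨ *-distribˡ-+ (χ x) (χ y₁) (χ y₂) ⟩
    χ x * χ y₁ + χ x * χ y₂      ≡⟨ sym (cong₂ _+_ (χ-∧ x y₁) (χ-∧ x y₂)) ⟩
    χ (x ∧ y₁) + χ (x ∧ y₂)      ∎
  where open ≡-Reasoning

doubleSum-cong : ∀ n (F G : ℕ → ℕ → ℕ) → (∀ v w → v ≤ n → w ≤ n → F v w ≡ G v w) → doubleSum n F ≡ doubleSum n G
doubleSum-cong n F G h =
  sumBelow-cong (suc n) (λ v v≤n → sumBelow-cong (suc n) (λ w w≤n → h v w (≤-pred v≤n) (≤-pred w≤n)))

doubleSum-+ : ∀ n (F G : ℕ → ℕ → ℕ) → doubleSum n (λ v w → F v w + G v w) ≡ doubleSum n F + doubleSum n G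
doubleSum-+ n F G = trans (sumBelow-cong (suc n) (λ v _ → sumBelow-+ (F v) (G v) (suc n)))
                          (sumBelow-+ (λ v → sumBelow (F v) (suc n)) (λ v → sumBelow (G v) (suc n)) (suc n))

doubleSum-reflect : ∀ n (F : ℕ → ℕ → ℕ) → doubleSum n F ≡ doubleSum n (λ v w → F (n ∸ w) (n ∸ v))
doubleSum-reflect n F = begin
    sumBelow (λ v → sumBelow (F v) (suc n)) (suc n)
      ≡⟨ sumBelow-cong (suc n) (λ v _ → sumBelow-reflect (F v) (suc n)) ⟩
    sumBelow (λ v → sumBelow (λ w → F v (n ∸ w)) (suc n)) (suc n)
      ≡⟨ sumBelow-reflect _ (suc n) ⟩
    sumBelow (λ v → sumBelow (λ w → F (n ∸ v) (n ∸ w)) (suc n)) (suc n)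
      ≡⟨ sumBelow-swap (λ v w → F (n ∸ v) (n ∸ w)) (suc n) (suc n) ⟩
    sumBelow (λ w → sumBelow (λ v → F (n ∸ v) (n ∸ w)) (suc n)) (suc n)    ∎
  where open ≡-Reasoning

pairCount-splitˡ : ∀ n {S} S₁ S₂ T k → (∀ v → χ (S v) ≡ χ (S₁ v) + χ (S₂ v)) →
  pairCount n S T k ≡ pairCount n S₁ T k + pairCount n S₂ T k
pairCount-splitˡ n S₁ S₂ T k split =
  trans (doubleSum-cong n _ _ (λ v w _ _ → χ-∧-splitˡ (S₁ v) (S₂ v) _ (split v))) (doubleSum-+ n _ _)

pairCount-splitʳ : ∀ n S {T} T₁ T₂ k → (∀ w → χ (T w) ≡ χ (T₁ w) + χ (T₂ w)) →
  pairCount n S T k ≡ pairCount n S T₁ k + pairCount n S T₂ k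
pairCount-splitʳ n S T₁ T₂ k split = trans (doubleSum-cong n _ _ (λ v w _ _ →
  χ-∧-splitʳ (S v) (T₁ w ∧ (v ≡ᵇ w + k)) (T₂ w ∧ (v ≡ᵇ w + k)) (χ-∧-splitˡ (T₁ w) (T₂ w) _ (split w)))) (doubleSum-+ n _ _)

reflect-≡ᵇ : ∀ n v w k → v ≤ n → w ≤ n → ((n ∸ w) ≡ᵇ (n ∸ v) + k) ≡ (v ≡ᵇ w + k)
reflect-≡ᵇ n v w k v≤n w≤n = bool-ext (≡ᵇ-true ∘ to ∘ ≡ᵇ-sound) (≡ᵇ-true ∘ from ∘ ≡ᵇ-sound)
  where
  to : n ∸ w ≡ n ∸ v + k → v ≡ w + k
  to e = +-cancelˡ-≡ (n ∸ v) v (w + k) (begin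
      n ∸ v + v          ≡⟨ m∸n+n≡m v≤n ⟩
      n                  ≡⟨ sym (m∸n+n≡m w≤n) ⟩
      n ∸ w + w          ≡⟨ cong (_+ w) e ⟩
      n ∸ v + k + w      ≡⟨ solve 3 (λ x k w → x :+ k :+ w := x :+ (w :+ k)) refl (n ∸ v) k w ⟩
      n ∸ v + (w + k)    ∎)
    where open ≡-Reasoning
  from : v ≡ w + k → n ∸ w ≡ n ∸ v + k
  from e = +-cancelʳ-≡ w (n ∸ w) (n ∸ v + k) (begin
      n ∸ w + w          ≡⟨ m∸n+n≡m w≤n ⟩
      n                  ≡⟨ sym (m∸n+n≡m v≤n) ⟩
      n ∸ v + v          ≡⟨ cong (n ∸ v +_) e ⟩
      n ∸ v + (w + k)    ≡⟨ solve 3 (λ x w k → x :+ (w :+ k) := x :+ k :+ w) refl (n ∸ v) w k ⟩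
      n ∸ v + k + w      ∎)
    where open ≡-Reasoning

∧-exchange : ∀ x y z → (x ∧ y ∧ z) ≡ (y ∧ x ∧ z)
∧-exchange true  y z = refl
∧-exchange false y z = sym (∧-zeroʳ y)

pairCount-reflect : ∀ n (S T : ℕ → Bool) k → pairCount n S T k ≡ pairCount n (T ∘ (n ∸_)) (S ∘ (n ∸_)) k
pairCount-reflect n S T k = trans (doubleSum-reflect n _) (doubleSum-cong n _ _ (λ v w v≤n w≤n →
  cong χ (trans (cong (λ t → S (n ∸ w) ∧ T (n ∸ v) ∧ t) (reflect-≡ᵇ n v w k v≤n w≤n)) (∧-exchange (S (n ∸ w)) (T (n ∸ v)) _))))

pairCount-cong : ∀ n {S S′ T T′ : ℕ → Bool} k → (∀ v → v ≤ n → S v ≡ S′ v) → (∀ w → w ≤ n → T w ≡ T′ w) →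
  pairCount n S T k ≡ pairCount n S′ T′ k
pairCount-cong n k S≡S′ T≡T′ = doubleSum-cong n _ _ (λ v w v≤n w≤n →
  cong₂ (λ s t → χ (s ∧ t ∧ (v ≡ᵇ w + k))) (S≡S′ v v≤n) (T≡T′ w w≤n))

cancel-common : ∀ ce cN de dN cd ed eN → ce + cN + (de + dN) ≡ cd + cN + (ed + eN) → de ≡ ed → ce + dN ≡ cd + eN
cancel-common ce cN de dN cd ed eN total refl = +-cancelʳ-≡ (cN + de) _ _ (begin
    ce + dN + (cN + de)
      ≡⟨ solve 4 (λ ce dN cN de → ce :+ dN :+ (cN :+ de) := ce :+ cN :+ (de :+ dN)) refl ce dN cN de ⟩
    ce + cN + (de + dN)
      ≡⟨ total ⟩
    cd + cN + (de + eN)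
      ≡⟨ solve 4 (λ cd cN de eN → cd :+ cN :+ (de :+ eN) := cd :+ eN :+ (cN :+ de)) refl cd cN de eN ⟩
    cd + eN + (cN + de)        ∎)
  where open ≡-Reasoning

cancel-differences : ∀ X₁ X₂ Y₁ Y₂ α β γ δ → X₁ + α ≡ X₂ + β → Y₁ + γ ≡ Y₂ + δ → Y₂ + X₁ ≡ X₂ + Y₁ → β + γ ≡ α + δ
cancel-differences X₁ X₂ Y₁ Y₂ α β γ δ e₁ e₂ e₃ = +-cancelˡ-≡ (X₂ + Y₁) (β + γ) (α + δ) (begin
    X₂ + Y₁ + (β + γ)
      ≡⟨ +-interchange X₂ Y₁ β γ ⟩
    (X₂ + β) + (Y₁ + γ)
      ≡⟨ cong₂ _+_ (sym e₁) e₂ ⟩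
    (X₁ + α) + (Y₂ + δ)
      ≡⟨ solve 4 (λ X₁ α Y₂ δ → (X₁ :+ α) :+ (Y₂ :+ δ) := (Y₂ :+ X₁) :+ (α :+ δ)) refl X₁ α Y₂ δ ⟩
    (Y₂ + X₁) + (α + δ)
      ≡⟨ cong (_+ (α + δ)) e₃ ⟩
    X₂ + Y₁ + (α + δ)       ∎)
  where open ≡-Reasoning

χ-injective : ∀ {x y} → χ x ≡ χ y → x ≡ y
χ-injective {true}  {true}  _ = refl
χ-injective {false} {false} _ = refl

balance⇒≡ : ∀ a b x y → ((a ∧ not b) ∨ (not a ∧ b)) ≡ true →
  χ ((a ∧ not b) ∧ x) + χ ((not a ∧ b) ∧ y) ≡ χ ((a ∧ not b) ∧ y) + χ ((not a ∧ b) ∧ x) → x ≡ y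
balance⇒≡ true  false x y _ e = χ-injective (trans (sym (+-identityʳ (χ x))) (trans e (+-identityʳ (χ y))))
balance⇒≡ false true  x y _ e = χ-injective (sym e)

inΔ⇒neither : ∀ a b → ((a ∧ not b) ∨ (not a ∧ b)) ≡ true → (not a ∧ not b) ≡ false × (a ∧ b) ≡ false
inΔ⇒neither true  false _ = refl , refl
inΔ⇒neither false true  _ = refl , refl

outsideΔ-swap : ∀ av bv aw bw → ((av ∧ not bv) ∨ (not av ∧ bv)) ≡ false → ((aw ∧ not bw) ∨ (not aw ∧ bw)) ≡ false →
  (not aw ∧ not bw) ≡ (av ∧ bv) → (not av ∧ not bv) ≡ (aw ∧ bw)
outsideΔ-swap true  true  false false _ _ _ = refl
outsideΔ-swap false false true  true  _ _ _ = refl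
outsideΔ-swap true  true  true  true  _ _ ()
outsideΔ-swap false false false false _ _ ()
outsideΔ-swap true  false _ _ () _ _
outsideΔ-swap false true  _ _ () _ _
outsideΔ-swap _ _ true  false _ () _
outsideΔ-swap _ _ false true  _ () _

matching⇒b≡not-a : ∀ av bv aw bw → (not av ∧ not bv) ≡ (aw ∧ bw) → (av ∧ not bv) ≡ (aw ∧ not bw) →
  (not av ∧ bv) ≡ (not aw ∧ bw) → bv ≡ not aw
matching⇒b≡not-a av    true  false bw    _  _  _  = refl
matching⇒b≡not-a av    false true  bw    _  _  _  = refl
matching⇒b≡not-a true  true  true  true  () _  _
matching⇒b≡not-a false true  true  true  () _  _
matching⇒b≡not-a true  true  true  false _  () _
matching⇒b≡not-a false true  true  false _  () _
matching⇒b≡not-a true  false false bw    _  () _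
matching⇒b≡not-a false false false true  () _  _
matching⇒b≡not-a false false false false () _  _

∧-cong-under : ∀ s t t′ e → (s ≡ true → e ≡ true → t ≡ t′) → (s ∧ t ∧ e) ≡ (s ∧ t′ ∧ e)
∧-cong-under false t t′ e h = refl
∧-cong-under true  t t′ false h = trans (∧-zeroʳ t) (sym (∧-zeroʳ t′))
∧-cong-under true  t t′ true  h = cong (_∧ true) (h refl refl)

largest : ∀ (p : ℕ → Bool) k →
  (Σ ℕ λ j → j ≤ k × p j ≡ true × (∀ v → j < v → v ≤ k → p v ≡ false)) ⊎ (∀ v → v ≤ k → p v ≡ false)
largest p zero with p 0 in p0
... | true  = inj₁ (0 , z≤n , p0 , λ v 0<v v≤0 → ⊥-elim (<-irrefl refl (<-≤-trans 0<v v≤0)))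
... | false = inj₂ (λ { .0 z≤n → p0 })
largest p (suc k) with p (suc k) in pk | largest p k
... | true  | _ = inj₁ (suc k , ≤-refl , pk , λ v k<v v≤k → ⊥-elim (<-irrefl refl (<-≤-trans k<v v≤k)))
... | false | inj₁ (j , j≤k , pj , above) =
  inj₁ (j , m≤n⇒m≤1+n j≤k , pj , λ v j<v v≤1+k → extend (λ v≤k → above v j<v v≤k) v≤1+k)
  where
  extend : ∀ {v} → (v ≤ k → p v ≡ false) → v ≤ suc k → p v ≡ false
  extend below v≤1+k with m≤n⇒m<n∨m≡n v≤1+k
  ... | inj₁ v<1+k = below (≤-pred v<1+k)
  ... | inj₂ refl  = pk
... | false | inj₂ none = inj₂ extend
  where
  extend : ∀ v → v ≤ suc k → p v ≡ false
  extend v v≤1+k with m≤n⇒m<n∨m≡n v≤1+k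
  ... | inj₁ v<1+k = none v (≤-pred v<1+k)
  ... | inj₂ refl  = pk

outsideΔ⇒≡ : ∀ a b → ((a ∧ not b) ∨ (not a ∧ b)) ≡ false → a ≡ b
outsideΔ⇒≡ true  true  _ = refl
outsideΔ⇒≡ false false _ = refl

-- Let a, b be the membership predicates of β-sets A, B ⊆ {1,…,n}
-- with n ∈ B, the same hook multisets and n-symmetric differences d = A ∖ B, e = B ∖ A.
-- With c = A ∩ B, N = the complement of A ∪ B and c̄(v) = c(n − v), the hook
-- equality reduces to a balance between d and e (balance).  Peeling off the pairs
-- at the largest element j of the symmetric difference shows N = c̄ below j, and then
-- on all of [0, n]; this determines B from A as the conjugate β-set.
module Reconstruction (n : ℕ) (a b : ℕ → Bool) (n∈B : b n ≡ true)
  (d-symmetric : ∀ v → v ≤ n → (a v ∧ not (b v)) ≡ (a (n ∸ v) ∧ not (b (n ∸ v))))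
  (e-symmetric : ∀ v → v ≤ n → (not (a v) ∧ b v) ≡ (not (a (n ∸ v)) ∧ b (n ∸ v)))
  (sameHooks : ∀ k → 1 ≤ k → pairCount n a (not ∘ a) k ≡ pairCount n b (not ∘ b) k) where

  c d e N c̄ Δ : ℕ → Bool
  c v = a v ∧ b v
  d v = a v ∧ not (b v)
  e v = not (a v) ∧ b v
  N v = not (a v) ∧ not (b v)
  c̄ v = c (n ∸ v)
  Δ v = d v ∨ e v

  pairs-of-a : ∀ k → pairCount n a (not ∘ a) k ≡
    pairCount n c e k + pairCount n c N k + (pairCount n d e k + pairCount n d N k)
  pairs-of-a k = trans (pairCount-splitˡ n c d (not ∘ a) k (λ v → χ-split (a v) (b v)))
    (cong₂ _+_ (pairCount-splitʳ n c e N k split-¬a) (pairCount-splitʳ n d e N k split-¬a))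
    where
    split-¬a : ∀ w → χ (not (a w)) ≡ χ (e w) + χ (N w)
    split-¬a w = χ-split (not (a w)) (b w)

  pairs-of-b : ∀ k → pairCount n b (not ∘ b) k ≡
    pairCount n c d k + pairCount n c N k + (pairCount n e d k + pairCount n e N k)
  pairs-of-b k = trans (pairCount-splitˡ n c e (not ∘ b) k split-b)
    (cong₂ _+_ (pairCount-splitʳ n c d N k split-¬b) (pairCount-splitʳ n e d N k split-¬b))
    where
    split-b : ∀ v → χ (b v) ≡ χ (c v) + χ (e v)
    split-b v = trans (χ-split (b v) (a v))
                      (cong₂ (λ x y → χ x + χ y) (∧-comm (b v) (a v)) (∧-comm (b v) (not (a v))))
    split-¬b : ∀ w → χ (not (b w)) ≡ χ (d w) + χ (N w)
    split-¬b w = trans (χ-split (not (b w)) (a w))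
                       (cong₂ (λ x y → χ x + χ y) (∧-comm (not (b w)) (a w)) (∧-comm (not (b w)) (not (a w))))

  -- Reflection, using the symmetry of d and e.
  de≡ed : ∀ k → pairCount n d e k ≡ pairCount n e d k
  de≡ed k = trans (pairCount-reflect n d e k)
                  (pairCount-cong n k (λ v v≤n → sym (e-symmetric v v≤n)) (λ w w≤n → sym (d-symmetric w w≤n)))

  ce≡ec̄ : ∀ k → pairCount n c e k ≡ pairCount n e c̄ k
  ce≡ec̄ k = trans (pairCount-reflect n c e k) (pairCount-cong n k (λ v v≤n → sym (e-symmetric v v≤n)) (λ _ _ → refl))

  cd≡dc̄ : ∀ k → pairCount n c d k ≡ pairCount n d c̄ k
  cd≡dc̄ k = trans (pairCount-reflect n c d k) (pairCount-cong n k (λ v v≤n → sym (d-symmetric v v≤n)) (λ _ _ → refl))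

  balance : ∀ k → 1 ≤ k → pairCount n e c̄ k + pairCount n d N k ≡ pairCount n d c̄ k + pairCount n e N k
  balance k 1≤k = cancel-common (pairCount n e c̄ k) (pairCount n c N k) (pairCount n d e k) (pairCount n d N k)
                                (pairCount n d c̄ k) (pairCount n e d k) (pairCount n e N k) total (de≡ed k)
    where
    open ≡-Reasoning
    total : pairCount n e c̄ k + pairCount n c N k + (pairCount n d e k + pairCount n d N k) ≡
            pairCount n d c̄ k + pairCount n c N k + (pairCount n e d k + pairCount n e N k)
    total = begin
      pairCount n e c̄ k + pairCount n c N k + (pairCount n d e k + pairCount n d N k)
        ≡⟨ cong (λ t → t + pairCount n c N k + (pairCount n d e k + pairCount n d N k)) (sym (ce≡ec̄ k)) ⟩
      pairCount n c e k + pairCount n c N k + (pairCount n d e k + pairCount n d N k)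
        ≡⟨ sym (pairs-of-a k) ⟩
      pairCount n a (not ∘ a) k
        ≡⟨ sameHooks k 1≤k ⟩
      pairCount n b (not ∘ b) k
        ≡⟨ pairs-of-b k ⟩
      pairCount n c d k + pairCount n c N k + (pairCount n e d k + pairCount n e N k)
        ≡⟨ cong (λ t → t + pairCount n c N k + (pairCount n e d k + pairCount n e N k)) (cd≡dc̄ k) ⟩
      pairCount n d c̄ k + pairCount n c N k + (pairCount n e d k + pairCount n e N k)
        ∎

  Δ-symmetric : ∀ v → v ≤ n → Δ v ≡ Δ (n ∸ v)
  Δ-symmetric v v≤n = cong₂ _∨_ (d-symmetric v v≤n) (e-symmetric v v≤n)

  module FromLargest (j : ℕ) (j≤n : j ≤ n) (j∈Δ : Δ j ≡ true) (j-max : ∀ v → j < v → v ≤ n → Δ v ≡ false) where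

    Δ⇒≤j : ∀ v → v ≤ n → Δ v ≡ true → v ≤ j
    Δ⇒≤j v v≤n v∈Δ with v ≤? j
    ... | yes v≤j = v≤j
    ... | no  v≰j = ⊥-elim (true≢false (trans (sym v∈Δ) (j-max v (≰⇒> v≰j) v≤n)))
      where true≢false : true ≢ false
            true≢false ()

    -- N y = c̄ y, given it below y: compare the pairs at distance j − y.  All rows v < j
    -- agree by hypothesis, so only the row v = j, i.e. the pair (j, y), remains.
    peel : ∀ y → y < j → (∀ y′ → y′ < y → N y′ ≡ c̄ y′) → N y ≡ c̄ y
    peel y y<j below = balance⇒≡ (a j) (b j) (N y) (c̄ y) j∈Δ topRows
      where
      k : ℕ
      k = j ∸ y
      j≡y+k : j ≡ y + k
      j≡y+k = sym (m+[n∸m]≡n (<⇒≤ y<j))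
      row : (ℕ → Bool) → (ℕ → Bool) → ℕ → ℕ
      row S T v = sumBelow (λ w → χ (S v ∧ T w ∧ (v ≡ᵇ w + k))) (suc n)
      onlyTopRow : ∀ S → (∀ v → v ≤ n → S v ≡ true → v ≤ j) →
        pairCount n S N k + row S c̄ j ≡ pairCount n S c̄ k + row S N j
      onlyTopRow S S≤j = sumBelow-differAt (row S N) (row S c̄) (suc n) j (s≤s j≤n) (λ v v≤n v≢j →
        sumBelow-cong (suc n) (λ w _ → cong χ (∧-cong-under (S v) (N w) (c̄ w) (v ≡ᵇ w + k) (λ Sv v≡w+k →
          below w (+-cancelʳ-< k w y (subst₂ _<_ (≡ᵇ-sound v≡w+k) j≡y+k (≤∧≢⇒< (S≤j v (≤-pred v≤n) Sv) v≢j)))))))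
      topRow : ∀ S T → row S T j ≡ χ (S j ∧ T y)
      topRow S T = begin
          row S T j
            ≡⟨ sumBelow-single _ (suc n) y (s≤s (≤-trans (<⇒≤ y<j) j≤n)) offDiagonal ⟩
          χ (S j ∧ T y ∧ (j ≡ᵇ y + k))
            ≡⟨ cong (λ t → χ (S j ∧ T y ∧ t)) (≡ᵇ-true j≡y+k) ⟩
          χ (S j ∧ T y ∧ true)
            ≡⟨ cong (λ t → χ (S j ∧ t)) (∧-identityʳ (T y)) ⟩
          χ (S j ∧ T y)                         ∎
        where
        open ≡-Reasoning
        offDiagonal : ∀ w → w < suc n → w ≢ y → χ (S j ∧ T w ∧ (j ≡ᵇ w + k)) ≡ 0
        offDiagonal w _ w≢y rewrite ≡ᵇ-false {j} {w + k} (λ j≡w+k → w≢y (+-cancelʳ-≡ k w y (trans (sym j≡w+k) j≡y+k)))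
          = cong χ (trans (cong (S j ∧_) (∧-zeroʳ (T w))) (∧-zeroʳ (S j)))
      topRows : χ (d j ∧ N y) + χ (e j ∧ c̄ y) ≡ χ (d j ∧ c̄ y) + χ (e j ∧ N y)
      topRows = subst₂ (λ p q → p + q ≡ χ (d j ∧ c̄ y) + χ (e j ∧ N y)) (topRow d N) (topRow e c̄)
        (subst₂ (λ p q → row d N j + row e c̄ j ≡ p + q) (topRow d c̄) (topRow e N)
          (cancel-differences (pairCount n d N k) (pairCount n d c̄ k) (pairCount n e N k) (pairCount n e c̄ k)
            (row d c̄ j) (row d N j) (row e c̄ j) (row e N j)
            (onlyTopRow d (λ v v≤n dv → Δ⇒≤j v v≤n (cong (_∨ e v) dv)))
            (onlyTopRow e (λ v v≤n ev → Δ⇒≤j v v≤n (trans (cong (d v ∨_) ev) (∨-zeroʳ (d v)))))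
            (balance k (m<n⇒0<n∸m y<j))))

    N≡c̄-below : ∀ y → y < j → N y ≡ c̄ y
    N≡c̄-below = <-rec (λ y → y < j → N y ≡ c̄ y) (λ y rec y<j → peel y y<j (λ y′ y′<y → rec y′<y (<-trans y′<y y<j)))

    -- n − j is in the symmetric difference too, hence n − j ≤ j.
    n-j∈Δ : Δ (n ∸ j) ≡ true
    n-j∈Δ = trans (sym (Δ-symmetric j j≤n)) j∈Δ

    N≡c-reflected : ∀ y → y ≤ n → N y ≡ c (n ∸ y)
    N≡c-reflected y y≤n with <-cmp y j
    ... | tri< y<j _ _ = N≡c̄-below y y<j
    ... | tri≈ _ refl _ =
      trans (proj₁ (inΔ⇒neither (a y) (b y) j∈Δ)) (sym (proj₂ (inΔ⇒neither (a (n ∸ y)) (b (n ∸ y)) n-j∈Δ)))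
    ... | tri> _ _ j<y = outsideΔ-swap (a y) (b y) (a (n ∸ y)) (b (n ∸ y)) y∉Δ n-y∉Δ
            (subst (λ z → N (n ∸ y) ≡ c z) (m∸[m∸n]≡n y≤n)
              (N≡c̄-below (n ∸ y) (<-≤-trans (∸-monoʳ-< j<y y≤n) (Δ⇒≤j (n ∸ j) (m∸n≤m n j) n-j∈Δ))))
      where
      y∉Δ : Δ y ≡ false
      y∉Δ = j-max y j<y y≤n
      n-y∉Δ : Δ (n ∸ y) ≡ false
      n-y∉Δ = trans (sym (Δ-symmetric y y≤n)) y∉Δ

    b≡conjugate : ∀ v → 1 ≤ v → v ≤ n → b v ≡ ((v ≡ᵇ n) ∨ not (a (n ∸ v)))
    b≡conjugate v 1≤v v≤n with m≤n⇒m<n∨m≡n v≤n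
    ... | inj₂ refl rewrite ≡ᵇ-true {v} refl = n∈B
    ... | inj₁ v<n rewrite ≡ᵇ-false (<⇒≢ v<n) =
      matching⇒b≡not-a (a v) (b v) (a (n ∸ v)) (b (n ∸ v)) (N≡c-reflected v v≤n) (d-symmetric v v≤n) (e-symmetric v v≤n)

symmetric⇒conjugateSet : ∀ n′ (A B : Subset (suc n′)) → A ≢ B → member A (suc n′) ≡ true → member B (suc n′) ≡ true →
  hooks (lam A) ↭ hooks (lam B) → Symmetric (suc n′) (A ─ B) → Symmetric (suc n′) (B ─ A) → B ≡ conjugateSet (suc n′) A
symmetric⇒conjugateSet n′ A B A≢B n∈A n∈B sameHooks sym-A─B sym-B─A = fromLargest (largest Δ n)
  where
  n : ℕ
  n = suc n′
  a b : ℕ → Bool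
  a = member A
  b = member B
  d-symmetric : ∀ v → v ≤ n → (a v ∧ not (b v)) ≡ (a (n ∸ v) ∧ not (b (n ∸ v)))
  d-symmetric v v≤n = begin
    a v ∧ not (b v)                  ≡⟨ sym (member-─ A B v) ⟩
    member (A ─ B) v                 ≡⟨ symmetric⇒member n (A ─ B) sym-A─B v v≤n ⟩
    member (A ─ B) (n ∸ v)           ≡⟨ member-─ A B (n ∸ v) ⟩
    a (n ∸ v) ∧ not (b (n ∸ v))      ∎
    where open ≡-Reasoning
  e-symmetric : ∀ v → v ≤ n → (not (a v) ∧ b v) ≡ (not (a (n ∸ v)) ∧ b (n ∸ v))
  e-symmetric v v≤n = begin
    not (a v) ∧ b v                  ≡⟨ ∧-comm (not (a v)) (b v) ⟩
    b v ∧ not (a v)                  ≡⟨ sym (member-─ B A v) ⟩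
    member (B ─ A) v                 ≡⟨ symmetric⇒member n (B ─ A) sym-B─A v v≤n ⟩
    member (B ─ A) (n ∸ v)           ≡⟨ member-─ B A (n ∸ v) ⟩
    b (n ∸ v) ∧ not (a (n ∸ v))      ≡⟨ ∧-comm (b (n ∸ v)) (not (a (n ∸ v))) ⟩
    not (a (n ∸ v)) ∧ b (n ∸ v)      ∎
    where open ≡-Reasoning
  pairCounts-equal : ∀ k → 1 ≤ k → pairCount n a (not ∘ a) k ≡ pairCount n b (not ∘ b) k
  pairCounts-equal k 1≤k = begin
    pairCount n a (not ∘ a) k        ≡⟨ sym (hook-multiplicity n′ A n∈A k 1≤k) ⟩
    multiplicity k (hooks (lam A))   ≡⟨ multiplicity-↭ k sameHooks ⟩
    multiplicity k (hooks (lam B))   ≡⟨ hook-multiplicity n′ B n∈B k 1≤k ⟩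
    pairCount n b (not ∘ b) k        ∎
    where open ≡-Reasoning
  open Reconstruction n a b n∈B d-symmetric e-symmetric pairCounts-equal
  fromLargest : (Σ ℕ λ j → j ≤ n × Δ j ≡ true × (∀ v → j < v → v ≤ n → Δ v ≡ false)) ⊎ (∀ v → v ≤ n → Δ v ≡ false) →
    B ≡ conjugateSet n A
  fromLargest (inj₂ Δ-empty) = ⊥-elim (A≢B (member-ext A B (λ v _ v≤n → outsideΔ⇒≡ (a v) (b v) (Δ-empty v v≤n))))
  fromLargest (inj₁ (j , j≤n , j∈Δ , j-max)) = member-ext B (conjugateSet n A) (λ v 1≤v v≤n →
    trans (FromLargest.b≡conjugate j j≤n j∈Δ j-max v 1≤v v≤n) (sym (member-tabulate (conjugateTest n A) v 1≤v v≤n)))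

theorem1 : (n : ℕ) → 1 ≤ n → (A B : Subset n) → A ≢ B →
    (n ∈ₛ A) × (n ∈ₛ B) → hooks (lam A) ↭ hooks (lam B) →
    (lam B ≡ conj (lam A)) ⇔ (Symmetric n (A ─ B) × Symmetric n (B ─ A))
theorem1 (suc n′) (s≤s z≤n) A B A≢B (n∈ₛA , n∈ₛB) sameHooks = mk⇔ conjugate⇒symmetric symmetric⇒conjugate
  where
  n∈A : member A (suc n′) ≡ true
  n∈A = ∈ₛ⇒member A (suc n′) n∈ₛA
  n∈B : member B (suc n′) ≡ true
  n∈B = ∈ₛ⇒member B (suc n′) n∈ₛB
  open Conjugate n′ A n∈A using (A*; conj-lam; differences-symmetric)
  -- λ_B = λ_A' means B = A*, whose differences with A are symmetric
  conjugate⇒symmetric : lam B ≡ conj (lam A) → Symmetric (suc n′) (A ─ B) × Symmetric (suc n′) (B ─ A)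
  conjugate⇒symmetric λB≡λA′ =
    subst (λ X → Symmetric (suc n′) (A ─ X) × Symmetric (suc n′) (X ─ A)) (sym B≡A*) differences-symmetric
    where
    B≡A* : B ≡ A*
    B≡A* = lam-injective B A* (trans λB≡λA′ conj-lam)
  symmetric⇒conjugate : Symmetric (suc n′) (A ─ B) × Symmetric (suc n′) (B ─ A) → lam B ≡ conj (lam A)
  symmetric⇒conjugate (sym-A─B , sym-B─A) =
    trans (cong lam (symmetric⇒conjugateSet n′ A B A≢B n∈A n∈B sameHooks sym-A─B sym-B─A)) (sym conj-lam)
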